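{- Let $H$ be a fixed regular, strictly $2$-balanced graph and fix an edge $f$ of $K_n$. Then the event $E_3$ implies the event $E_2(f)$.
   Context: $H$ has $v_H$ vertices and $e_H$ edges; strictly $2$-balanced means $v_H,e_H\ge 3$ and $(e_H-1)/(v_H-2) > (e_F-1)/(v_F-2)$ for every proper subgraph $F\subsetneq H$ with $v_F\ge 3$. $K_n$ is the complete graph on $\{1,\dots,n\}$; subgraphs are identified with their edge sets (and their vertex sets are the endpoints of their edges). Define $k = n^{(\ln n)^{ -1/2}}$, $\rho = k n^{ -(v_H-2)/(e_H-1)}$, $D = 2\lfloor(\ln n)^{1/4}\rfloor+1$. $\mathbb{G}(n,\rho)$ is the Erdős–Rényi random graph with edge probability $\rho$ (each edge included independently). For an edge $g$, $\Lambda(g,\rho)$ is the set of all $G\subseteq \mathbb{G}(n,\rho)\setminus\{g\}$ with $G\cup\{g\}$ isomorphic to $H$, and $\Lambda(g,1)$ the set of all $G\subseteq K_n\setminus\{g\}$ with $G\cup\{g\}$ isomorphic to $H$. A sequence $S=(G_1,\dots,G_d)$ of subgraphs of $K_n$ with $2\le d\le 2D$ is a bad sequence if: (1) for all $j\in[d]$, $G_j\in\Lambda(g,1)$ for some edge $g\in\{f\}\cup\bigcup_{i<j}G_i$; (2) for all $j\in[d-1]$, $G_j$ shares exactly $2$ vertices and $0$ edges with $\{f\}\cup\bigcup_{i<j}G_i$; (3) $G_d$ shares at least $3$ vertices and at most $e_H-2$ edges with $\{f\}\cup\bigcup_{i<d}G_i$. Event $E_3$: there is no bad sequence $S$ with $G_j\subseteq\mathbb{G}(n,\rho)$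 for all $j$. Tree $T_{f,d}$: $T_{f,1}$ has root $v_0$ labeled $f$; for each $G_1\in\Lambda(f,\rho)$ a child $u_1$ of $v_0$ labeled $G_1$, and for each edge $g\in G_1$ a child of $u_1$ labeled $g$. For $d\ge2$, $T_{f,d}$ extends $T_{f,d-1}$: for each root-to-leaf path $(v_0,u_1,v_1,\dots,u_{d-1},v_{d-1})$ with $g_{d-1},g_{d-2}$ the labels of $v_{d-1},v_{d-2}$, for every $G_d\in\Lambda(g_{d-1},\rho)$ with $g_{d-2}\notin G_d$ add a child $u_d$ of $v_{d-1}$ labeled $G_d$ and, for each $g_d\in G_d$, a child of $u_d$ labeled $g_d$. $T_{f,d}$ is good if: (P1) every label $G$ of a node at odd distance from the root satisfies $f\notin G$; (P2) labels of distinct nodes at odd distance from the root are edge-disjoint; (P3) each non-leaf node at even distance with label $g$ has $|\Lambda(g,\rho)|-O(1)$ children (constant depending only on $H$). Event $E_2(f)$: $T_{f,D}$ is good. -}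

module Defs where

open import Data.Nat using (ℕ; zero; suc; _+_; _*_; _∸_; _^_; _≤_; _<_)
open import Data.Bool using (Bool; true; false; _∧_; _∨_; if_then_else_)
open import Data.Fin as Fin using (Fin)
open import Data.Fin.Properties using (_≟_; _<?_)
open import Data.List using (List; []; _∷_; map; allFin; length)
open import Data.Nat.ListAction using (sum)
open import Data.Bool.ListAction using (any)
open import Data.Unit using (⊤)
open import Data.List.Relation.Unary.All using (All)
open import Data.List.Relation.Unary.AllPairs using (AllPairs)
open import Data.Product using (Σ; ∃; _×_; _,_)
open import Data.Sum using (_⊎_)
open import Data.Empty using (⊥)
open import Relation.Nullary using (¬_; yes; no)
open import Relation.Nullary.Decidable using (⌊_⌋)
open import Relation.Binary.PropositionalEquality using (_≡_)
open import Function.Definitions using (Injective)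

-- Graphs are identified with their edge sets.
-- An edge of K_m is an unordered pair {lo, hi} with lo < hi.

record Edge (m : ℕ) : Set where
  constructor edge
  field
    lo hi : Fin m
    .lt : lo Fin.< hi
open Edge public

EdgeSet : ℕ → Set
EdgeSet m = Edge m → Bool

_∈E_ : ∀ {m} → Edge m → EdgeSet m → Set
e ∈E A = A e ≡ true

_∉E_ : ∀ {m} → Edge m → EdgeSet m → Set
e ∉E A = A e ≡ false

_⊆E_ : ∀ {m} → EdgeSet m → EdgeSet m → Set
A ⊆E B = ∀ e → e ∈E A → e ∈E B

_∪E_ : ∀ {m} → EdgeSet m → EdgeSet m → EdgeSet m
(A ∪E B) e = A e ∨ B e

_∩E_ : ∀ {m} → EdgeSet m → EdgeSet m → EdgeSet m
(A ∩E B) e = A e ∧ B e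

single : ∀ {m} → Edge m → EdgeSet m
single g e = ⌊ lo e ≟ lo g ⌋ ∧ ⌊ hi e ≟ hi g ⌋

_≐_ : ∀ {m} → EdgeSet m → EdgeSet m → Set
A ≐ B = ∀ e → A e ≡ B e

adj : ∀ {m} → EdgeSet m → Fin m → Fin m → Bool
adj A i j with i <? j
... | yes p = A (edge i j p)
... | no _ with j <? i
...   | yes q = A (edge j i q)
...   | no _ = false

count : ∀ {a} {X : Set a} → (X → Bool) → List X → ℕ
count P xs = sum (map (λ x → if P x then 1 else 0) xs)

eSize : ∀ {m} → EdgeSet m → ℕ
eSize {m} A = sum (map (λ i → count (λ j → ⌊ i <? j ⌋ ∧ adj A i j) (allFin m)) (allFin m))

incident : ∀ {m} → EdgeSet m → Fin m → Bool
incident {m} A v = any (adj A v) (allFin m)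

vSize : ∀ {m} → EdgeSet m → ℕ
vSize {m} A = count (incident A) (allFin m)

degree : ∀ {m} → EdgeSet m → Fin m → ℕ
degree {m} A v = count (adj A v) (allFin m)

commonV : ∀ {m} → EdgeSet m → EdgeSet m → ℕ
commonV {m} A B = count (λ v → incident A v ∧ incident B v) (allFin m)

commonE : ∀ {m} → EdgeSet m → EdgeSet m → ℕ
commonE A B = eSize (A ∩E B)

-- The fixed graph H, given by its edge set hE on vertex set Fin m (v_H = m).

NoIsolated : ∀ {m} → EdgeSet m → Set
NoIsolated {m} hE = ∀ (v : Fin m) → incident hE v ≡ true

Regular : ∀ {m} → EdgeSet m → Set
Regular {m} hE = ∃ λ r → ∀ (v : Fin m) → degree hE v ≡ r

-- (e_H-1)/(v_H-2) > (e_F-1)/(v_F-2), cross-multiplied (denominators > 0)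
Strictly2Balanced : ∀ {m} → EdgeSet m → Set
Strictly2Balanced {m} hE =
  3 ≤ m × 3 ≤ eSize hE ×
  (∀ (F : EdgeSet m) → F ⊆E hE → (∃ λ e → e ∈E hE × e ∉E F) → 3 ≤ vSize F →
     (eSize F ∸ 1) * (m ∸ 2) < (eSize hE ∸ 1) * (vSize F ∸ 2))

Maps : ∀ {m n} → (Fin m → Fin n) → Edge m → Edge n → Set
Maps φ e' e = (φ (lo e') ≡ lo e × φ (hi e') ≡ hi e) ⊎ (φ (lo e') ≡ hi e × φ (hi e') ≡ lo e)

IsoToH : ∀ {m n} → EdgeSet m → EdgeSet n → Set
IsoToH {m} {n} hE A = Σ (Fin m → Fin n) λ φ → Injective _≡_ _≡_ φ ×
  (∀ e → e ∈E A → ∃ λ e' → e' ∈E hE × Maps φ e' e) ×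
  (∀ e' → e' ∈E hE → ∀ e → Maps φ e' e → e ∈E A)

InΛ1 : ∀ {m n} → EdgeSet m → Edge n → EdgeSet n → Set
InΛ1 hE g G = g ∉E G × IsoToH hE (G ∪E single g)

-- G ∈ Λ(g,ρ), where Gr is the realisation of 𝔾(n,ρ)
InΛ : ∀ {m n} → EdgeSet m → EdgeSet n → Edge n → EdgeSet n → Set
InΛ hE Gr g G = G ⊆E Gr × InΛ1 hE g G

-- |S| ≤ C for S given as a predicate on edge sets
AtMost : ∀ {n} → ℕ → (EdgeSet n → Set) → Set
AtMost C P = ∀ (L : List (EdgeSet _)) → All P L → AllPairs (λ A B → ¬ (A ≐ B)) L → length L ≤ C

-- D = 2⌊(ln n)^{1/4}⌋ + 1.
-- expSum x N = N! · Σ_{i≤N} x^i/i!  ; so e^x = sup_N expSum x N / N!.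

expSum : ℕ → ℕ → ℕ
expSum x zero = 1
expSum x (suc N) = suc N * expSum x N + x ^ suc N

fact : ℕ → ℕ
fact zero = 1
fact (suc N) = suc N * fact N

ExpLe : ℕ → ℕ → Set
ExpLe x n = ∀ N → expSum x N ≤ n * fact N

ExpGt : ℕ → ℕ → Set
ExpGt x n = ∃ λ N → n * fact N < expSum x N

-- D = 2 ⌊(ln n)^{1/4}⌋ + 1, i.e. D = 2k+1 with k^4 ≤ ln n < (k+1)^4
IsD : ℕ → ℕ → Set
IsD n D = ∃ λ k → D ≡ 2 * k + 1 × ExpLe (k ^ 4) n × ExpGt (suc k ^ 4) n

-- Bad sequences and E_3 (sequences are indexed 0..d-1)

anyBelow : ℕ → (ℕ → Bool) → Bool
anyBelow zero p = false
anyBelow (suc j) p = anyBelow j p ∨ p j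

prefixU : ∀ {n} → Edge n → (ℕ → EdgeSet n) → ℕ → EdgeSet n
prefixU f S j e = single f e ∨ anyBelow j (λ i → S i e)

BadSeq : ∀ {m n} → EdgeSet m → ℕ → Edge n → ℕ → (ℕ → EdgeSet n) → Set
BadSeq hE D f d S =
  2 ≤ d × d ≤ 2 * D ×
  (∀ j → j < d → ∃ λ g → g ∈E prefixU f S j × InΛ1 hE g (S j)) ×
  (∀ j → suc j < d → commonV (S j) (prefixU f S j) ≡ 2 × commonE (S j) (prefixU f S j) ≡ 0) ×
  (3 ≤ commonV (S (d ∸ 1)) (prefixU f S (d ∸ 1)) ×
   commonE (S (d ∸ 1)) (prefixU f S (d ∸ 1)) ≤ eSize hE ∸ 2)

E3 : ∀ {m n} → EdgeSet m → ℕ → Edge n → EdgeSet n → Set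
E3 hE D f Gr = ∀ d S → BadSeq hE D f d S → (∀ j → j < d → S j ⊆E Gr) → ⊥

-- The tree T_{f,D}.  A node is given by its root-to-node path
--   (v_0, u_1, v_1, ..., u_j [, v_j])
-- with labels g_0 = f, G_1, g_1, ..., G_j [, g_j]; G indexed 1..j, g indexed 0..j.

-- the labels G_1..G_j and g_0..g_{j-1} form a valid path ending at u_j
PathU : ∀ {m n} → EdgeSet m → EdgeSet n → Edge n → ℕ → (ℕ → EdgeSet n) → (ℕ → Edge n) → Set
PathU hE Gr f j G g =
  g 0 ≡ f ×
  (∀ i → 1 ≤ i → i ≤ j → InΛ hE Gr (g (i ∸ 1)) (G i) × (2 ≤ i → g (i ∸ 2) ∉E G i)) ×
  (∀ i → 1 ≤ i → i < j → g i ∈E G i)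

-- the labels G_1..G_j and g_0..g_j form a valid path ending at v_j
PathV : ∀ {m n} → EdgeSet m → EdgeSet n → Edge n → ℕ → (ℕ → EdgeSet n) → (ℕ → Edge n) → Set
PathV hE Gr f j G g = PathU hE Gr f j G g × (1 ≤ j → g j ∈E G j)

-- two odd-depth nodes (paths ending at u_j, u_j') are the same node
SameU : ∀ {n} → ℕ → (ℕ → EdgeSet n) → (ℕ → Edge n) → ℕ → (ℕ → EdgeSet n) → (ℕ → Edge n) → Set
SameU j G g j' G' g' = j ≡ j' × (∀ i → 1 ≤ i → i ≤ j → G i ≐ G' i) × (∀ i → i < j → g i ≡ g' i)

-- children of v_j (labelled g_j) are the G ∈ Λ(g_j,ρ) with g_{j-1} ∉ G (if j ≥ 1)
ChildOK : ∀ {n} → ℕ → (ℕ → Edge n) → EdgeSet n → Set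
ChildOK zero g G = ⊤
ChildOK (suc j) g G = g j ∉E G

Excluded : ∀ {n} → ℕ → (ℕ → Edge n) → EdgeSet n → Set
Excluded zero g G = ⊥
Excluded (suc j) g G = g j ∈E G

Good : ∀ {m n} → EdgeSet m → ℕ → ℕ → Edge n → EdgeSet n → Set
Good hE C D f Gr =
  (∀ j G g → 1 ≤ j → j ≤ D → PathU hE Gr f j G g → f ∉E G j) ×
  (∀ j G g j' G' g' → 1 ≤ j → j ≤ D → 1 ≤ j' → j' ≤ D →
     PathU hE Gr f j G g → PathU hE Gr f j' G' g' → ¬ SameU j G g j' G' g' →
     ∀ e → e ∈E G j → e ∈E G' j' → ⊥) ×
  -- (P3): every non-leaf even node v_j with label g_j has at least
  -- |Λ(g_j,ρ)| - C children, i.e. at most C members of Λ(g_j,ρ) are excluded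
  (∀ j G g → j < D → PathV hE Gr f j G g →
     (∃ λ G₀ → InΛ hE Gr (g j) G₀ × ChildOK j g G₀) →
     AtMost C (λ G₀ → InΛ hE Gr (g j) G₀ × Excluded j g G₀))

E2 : ∀ {m n} → EdgeSet m → ℕ → ℕ → Edge n → EdgeSet n → Set
E2 = Good

-- First, H has minimum degree at least 2: a 1-regular H is a perfect
-- matching, and deleting one of its edges violates strict 2-balancedness.
-- Hence in a copy K of H both endpoints of an edge h are vertices of K - h;
-- in particular the endpoints of g are vertices of every G ∈ Λ(g,1).
--
-- The tree is studied through sequences of copies of H: position i holds a
-- graph S_i and an attachment edge a_i in the prefix {f} ∪ ⋃_{k<i} S_k with
-- S_i ∪ {a_i} ≅ H.  Position i is tree-like if S_i meets its prefix in
-- exactly two vertices and no edge, as in condition (2) of a bad sequence.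
-- The key lemma `tree-or-collapse`: under E₃, if the positions before t are
-- tree-like, then t is tree-like or its copy equals an earlier one (otherwise
-- a bad sequence of length ≤ 2D can be extracted).  Along a root-to-leaf
-- path of T_{f,D}, and along two paths spliced where they diverge, no copy
-- repeats an earlier one; so all positions are tree-like, their graphs are
-- edge-disjoint and avoid f, which gives (P1) and (P2).  An excluded child
-- in (P3) must repeat its parent's copy, which determines it.
module Submission where

open import Defs
open import Data.Nat using (ℕ; zero; suc; _+_; _*_; _∸_; _≤_; _<_; z≤n; s≤s; s≤s⁻¹; _⊓_)
open import Data.Nat.Properties hiding (_≟_)
open import Data.Nat.Properties using () renaming (_≟_ to _≟ℕ_)
open import Data.Nat.Solver using (module +-*-Solver)
open import Data.Nat.ListAction using () renaming (sum to sumList)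
open import Data.Bool using (Bool; true; false; _∧_; _∨_; not; _xor_; if_then_else_)
open import Data.Bool.Properties using (∨-zeroʳ; ∧-zeroʳ; ∨-identityʳ; ∧-identityʳ; xor-same; T-≡)
open import Data.Bool.ListAction using (any; or)
open import Data.Fin as Fin using (Fin)
open import Data.Fin.Properties using (_≟_) renaming (_<?_ to _<ᶠ?_)
import Data.Fin.Properties as Finₚ
open import Data.List using ([]; _∷_; map; allFin; tabulate)
open import Data.List.Properties using (map-tabulate; map-cong)
open import Data.List.Relation.Unary.All using (_∷_)
open import Data.List.Relation.Unary.AllPairs using (_∷_)
open import Data.List.Relation.Unary.Any using (satisfied)
open import Data.List.Relation.Unary.Any.Properties using (any⁺; any⁻)
open import Data.List.Membership.Propositional using (lose)
open import Data.List.Membership.Propositional.Properties using (∈-allFin)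
open import Data.Product using (Σ; ∃; _×_; _,_; proj₁; proj₂)
open import Data.Sum using (_⊎_; inj₁; inj₂; [_,_]′)
open import Data.Empty using (⊥; ⊥-elim)
open import Function using (_∘_; id)
open import Function.Bundles using (Equivalence)
open import Relation.Nullary using (¬_; yes; no; Dec; does)
open import Relation.Nullary.Decidable using (⌊_⌋; recompute; _×-dec_)
open import Relation.Binary.PropositionalEquality
open import Relation.Binary.Definitions using (tri<; tri≈; tri>)
open import Algebra.Properties.CommutativeMonoid.Sum +-0-commutativeMonoid
  using (sum-cong-≗; ∑-distrib-+; ∑-comm) renaming (sum to ∑)
open import Algebra.Properties.CommutativeSemigroup +-commutativeSemigroup using (x∙yz≈y∙xz)

-- Finite sums over Fin n, of 0/1 indicators in particular.

𝟙 : Bool → ℕ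
𝟙 b = if b then 1 else 0

𝟙≤1 : ∀ b → 𝟙 b ≤ 1
𝟙≤1 true = ≤-refl
𝟙≤1 false = z≤n

𝟙-mono : ∀ {a b} → (a ≡ true → b ≡ true) → 𝟙 a ≤ 𝟙 b
𝟙-mono {false} _ = z≤n
𝟙-mono {true} h rewrite h refl = ≤-refl

𝟙≢0 : ∀ {b} → ¬ (𝟙 b ≡ 0) → b ≡ true
𝟙≢0 {true} _ = refl
𝟙≢0 {false} h = ⊥-elim (h refl)

-- The counting functions of `Defs` are list sums over `allFin`; we work
-- with the finite sums ∑ of the standard library instead.
sum-allFin : ∀ n (f : Fin n → ℕ) → sumList (map f (allFin n)) ≡ ∑ f
sum-allFin n f = trans (cong sumList (map-tabulate id f)) (sum-tabulate n f)
  where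
  sum-tabulate : ∀ n (f : Fin n → ℕ) → sumList (tabulate f) ≡ ∑ f
  sum-tabulate zero f = refl
  sum-tabulate (suc n) f = cong (f Fin.zero +_) (sum-tabulate n (f ∘ Fin.suc))

∑-const : ∀ n c → ∑ {n} (λ _ → c) ≡ n * c
∑-const zero c = refl
∑-const (suc n) c = cong (c +_) (∑-const n c)

∑-zero : ∀ n {f : Fin n → ℕ} → (∀ x → f x ≡ 0) → ∑ f ≡ 0
∑-zero n h = trans (sum-cong-≗ h) (trans (∑-const n 0) (*-zeroʳ n))

∑-mono : ∀ n {f g : Fin n → ℕ} → (∀ x → f x ≤ g x) → ∑ f ≤ ∑ g
∑-mono zero h = z≤n
∑-mono (suc n) h = +-mono-≤ (h Fin.zero) (∑-mono n (h ∘ Fin.suc))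

∑-mono-< : ∀ n {f g : Fin n → ℕ} → (∀ x → f x ≤ g x) → ∀ a → f a < g a → ∑ f < ∑ g
∑-mono-< (suc n) h Fin.zero lt = +-mono-<-≤ lt (∑-mono n (h ∘ Fin.suc))
∑-mono-< (suc n) h (Fin.suc a) lt = +-mono-≤-< (h Fin.zero) (∑-mono-< n (h ∘ Fin.suc) a lt)

∑-witness : ∀ n (f : Fin n → ℕ) → ¬ (∑ f ≡ 0) → ∃ λ x → ¬ (f x ≡ 0)
∑-witness zero f h = ⊥-elim (h refl)
∑-witness (suc n) f h with f Fin.zero in eq
... | suc _ = Fin.zero , λ z → 1+n≢0 (trans (sym eq) z)
... | zero with ∑-witness n (f ∘ Fin.suc) h
...   | x , p = Fin.suc x , p

without : ∀ {n} → Fin n → (Fin n → ℕ) → Fin n → ℕ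
without a f x = if does (x ≟ a) then 0 else f x

without-≢ : ∀ {n} {a x : Fin n} (f : Fin n → ℕ) → ¬ (x ≡ a) → without a f x ≡ f x
without-≢ {a = a} {x} f ne with x ≟ a
... | yes e = ⊥-elim (ne e)
... | no _ = refl

∑-split : ∀ n (f : Fin n → ℕ) a → ∑ f ≡ f a + ∑ (without a f)
∑-split (suc n) f Fin.zero = refl
∑-split (suc n) f (Fin.suc a) = begin
  f Fin.zero + ∑ (f ∘ Fin.suc)                       ≡⟨ cong (f Fin.zero +_) (∑-split n (f ∘ Fin.suc) a) ⟩
  f Fin.zero + (f (Fin.suc a) + ∑ (without a (f ∘ Fin.suc))) ≡⟨ x∙yz≈y∙xz (f Fin.zero) (f (Fin.suc a)) _ ⟩
  f (Fin.suc a) + (f Fin.zero + ∑ (without a (f ∘ Fin.suc))) ≡⟨⟩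
  f (Fin.suc a) + ∑ (without (Fin.suc a) f) ∎
  where open ≡-Reasoning

∑-point : ∀ n (f : Fin n → ℕ) a → f a ≤ ∑ f
∑-point n f a = subst (f a ≤_) (sym (∑-split n f a)) (m≤m+n _ _)

∑-supported : ∀ n (f : Fin n → ℕ) a → (∀ x → ¬ (x ≡ a) → f x ≡ 0) → ∑ f ≡ f a
∑-supported n f a h =
  trans (∑-split n f a) (trans (cong (f a +_) (∑-zero n vanish)) (+-identityʳ (f a)))
  where
  vanish : ∀ x → without a f x ≡ 0
  vanish x with x ≟ a
  ... | yes _ = refl
  ... | no ne = h x ne

∑-supported₂ : ∀ n (f : Fin n → ℕ) a b → (∀ x → ¬ (x ≡ a) → ¬ (x ≡ b) → f x ≡ 0) → ∑ f ≤ f a + f b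
∑-supported₂ n f a b h = begin
  ∑ f                                  ≡⟨ ∑-split n f a ⟩
  f a + ∑ (without a f)                ≡⟨ cong (f a +_) (∑-supported n (without a f) b vanish) ⟩
  f a + without a f b                  ≤⟨ +-monoʳ-≤ (f a) (below b) ⟩
  f a + f b                            ∎
  where
  open ≤-Reasoning
  below : ∀ x → without a f x ≤ f x
  below x with x ≟ a
  ... | yes _ = z≤n
  ... | no _ = ≤-refl
  vanish : ∀ x → ¬ (x ≡ b) → without a f x ≡ 0
  vanish x nb with x ≟ a
  ... | yes _ = refl
  ... | no na = h x na nb

∑-two : ∀ n (f : Fin n → ℕ) a b → ¬ (b ≡ a) → f a + f b ≤ ∑ f
∑-two n f a b nba = begin
  f a + f b                            ≡⟨ cong (f a +_) (sym (without-≢ f nba)) ⟩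
  f a + without a f b                  ≤⟨ +-monoʳ-≤ (f a) (∑-point n (without a f) b) ⟩
  f a + ∑ (without a f)                ≡⟨ sym (∑-split n f a) ⟩
  ∑ f                                  ∎
  where open ≤-Reasoning

∑-three : ∀ n (f : Fin n → ℕ) a b c → ¬ (b ≡ a) → ¬ (c ≡ a) → ¬ (c ≡ b) → f a + f b + f c ≤ ∑ f
∑-three n f a b c nba nca ncb = begin
  f a + f b + f c                      ≡⟨ +-assoc (f a) (f b) (f c) ⟩
  f a + (f b + f c)                    ≡⟨ cong (f a +_) (cong₂ _+_ (sym (without-≢ f nba)) (sym (without-≢ f nca))) ⟩
  f a + (without a f b + without a f c) ≤⟨ +-monoʳ-≤ (f a) (∑-two n (without a f) b c ncb) ⟩
  f a + ∑ (without a f)                ≡⟨ sym (∑-split n f a) ⟩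
  ∑ f                                  ∎
  where open ≤-Reasoning

∑-reindex : ∀ {m n} (φ : Fin m → Fin n) → (∀ {a b} → φ a ≡ φ b → a ≡ b) → (f : Fin n → ℕ) →
            (∀ v → ¬ (f v ≡ 0) → ∃ λ a → φ a ≡ v) → ∑ f ≡ ∑ (f ∘ φ)
∑-reindex {m} {n} φ inj f img = begin
  ∑ f                                  ≡⟨ sum-cong-≗ (λ v → sym (fibre v)) ⟩
  ∑ (λ v → ∑ (λ u → at (φ u) f v))     ≡⟨ ∑-comm (λ v u → at (φ u) f v) ⟩
  ∑ (λ u → ∑ (λ v → at (φ u) f v))     ≡⟨ sum-cong-≗ (λ u → ∑-supported n (at (φ u) f) (φ u) (at-≢ (φ u))) ⟩
  ∑ (λ u → at (φ u) f (φ u))           ≡⟨ sum-cong-≗ (λ u → at-≡ (φ u)) ⟩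
  ∑ (f ∘ φ)                            ∎
  where
  open ≡-Reasoning
  at : Fin n → (Fin n → ℕ) → Fin n → ℕ
  at b g x = if ⌊ x ≟ b ⌋ then g x else 0
  at-≢ : ∀ b x → ¬ (x ≡ b) → at b f x ≡ 0
  at-≢ b x ne with x ≟ b
  ... | yes e = ⊥-elim (ne e)
  ... | no _ = refl
  at-≡ : ∀ b → at b f b ≡ f b
  at-≡ b with b ≟ b
  ... | yes _ = refl
  ... | no ne = ⊥-elim (ne refl)
  fibre-zero : ∀ v → f v ≡ 0 → ∀ u → at (φ u) f v ≡ 0
  fibre-zero v fv u with v ≟ φ u
  ... | yes _ = fv
  ... | no _ = refl
  -- each v with f v ≠ 0 has exactly one preimage
  fibre : ∀ v → ∑ (λ u → at (φ u) f v) ≡ f v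
  fibre v with f v ≟ℕ 0
  ... | yes fv = trans (∑-zero m (fibre-zero v fv)) (sym fv)
  ... | no fv with img v fv
  ...   | a , refl = trans (∑-supported m _ a (λ u ne → at-≢ (φ u) (φ a) (λ e → ne (inj (sym e)))))
                       (at-≡ (φ a))

true≢false : true ≡ false → ⊥
true≢false ()

bool-ext : ∀ {a b : Bool} → (a ≡ true → b ≡ true) → (b ≡ true → a ≡ true) → a ≡ b
bool-ext {false} {false} _ _ = refl
bool-ext {false} {true} _ g = g refl
bool-ext {true} f _ = sym (f refl)

false-if : ∀ {b} → (b ≡ true → ⊥) → b ≡ false
false-if {false} _ = refl
false-if {true} h = ⊥-elim (h refl)

∧-elim : ∀ {a b} → a ∧ b ≡ true → a ≡ true × b ≡ true
∧-elim {true} {true} _ = refl , refl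

∧-intro : ∀ {a b} → a ≡ true → b ≡ true → a ∧ b ≡ true
∧-intro refl refl = refl

∨-elim : ∀ {a b} → a ∨ b ≡ true → a ≡ true ⊎ b ≡ true
∨-elim {true} _ = inj₁ refl
∨-elim {false} h = inj₂ h

∨-introˡ : ∀ {a} b → a ≡ true → a ∨ b ≡ true
∨-introˡ b refl = refl

∨-introʳ : ∀ a {b} → b ≡ true → a ∨ b ≡ true
∨-introʳ a refl = ∨-zeroʳ a

not-true : ∀ {b} → not b ≡ true → b ≡ false
not-true {false} _ = refl

∧-not-false : ∀ {a b} → a ≡ true → a ∧ not b ≡ false → b ≡ true
∧-not-false {b = true} _ _ = refl
∧-not-false {b = false} refl ()

edge-ext : ∀ {n} {e e' : Edge n} → lo e ≡ lo e' → hi e ≡ hi e' → e ≡ e'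
edge-ext {e = edge a b _} {edge .a .b _} refl refl = refl

_≟E_ : ∀ {n} (e e' : Edge n) → Dec (e ≡ e')
e ≟E e' with lo e ≟ lo e' | hi e ≟ hi e'
... | yes p | yes q = yes (edge-ext p q)
... | no np | _ = no (λ eq → np (cong lo eq))
... | _ | no nq = no (λ eq → nq (cong hi eq))

lo<hi : ∀ {n} (e : Edge n) → lo e Fin.< hi e
lo<hi (edge a b p) = recompute (a <ᶠ? b) p

lo≢hi : ∀ {n} (e : Edge n) → ¬ (lo e ≡ hi e)
lo≢hi e eq = Finₚ.<-irrefl eq (lo<hi e)

single-true : ∀ {n} {g e : Edge n} → single g e ≡ true → e ≡ g
single-true {g = g} {e} h with lo e ≟ lo g | hi e ≟ hi g
... | yes p | yes q = edge-ext p q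
... | no _ | _ = ⊥-elim (true≢false (sym h))
... | yes _ | no _ = ⊥-elim (true≢false (sym h))

single-refl : ∀ {n} (g : Edge n) → single g g ≡ true
single-refl g with lo g ≟ lo g | hi g ≟ hi g
... | yes _ | yes _ = refl
... | no ne | _ = ⊥-elim (ne refl)
... | yes _ | no ne = ⊥-elim (ne refl)

single-≢ : ∀ {n} {g e : Edge n} → ¬ (e ≡ g) → single g e ≡ false
single-≢ ne = false-if (λ s → ne (single-true s))

minus : ∀ {n} → EdgeSet n → Edge n → EdgeSet n
minus A h e = A e ∧ not (single h e)

minus-⊆ : ∀ {n} (A : EdgeSet n) h → minus A h ⊆E A
minus-⊆ A h e me = proj₁ (∧-elim {A e} me)

minus-∉ : ∀ {n} (A : EdgeSet n) h → h ∉E minus A h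
minus-∉ A h = trans (cong (λ b → A h ∧ not b) (single-refl h)) (∧-zeroʳ (A h))

minus-∈ : ∀ {n} (A : EdgeSet n) {h e} → e ∈E A → ¬ (e ≡ h) → e ∈E minus A h
minus-∈ A ae ne = ∧-intro ae (cong not (single-≢ ne))

minus-≢ : ∀ {n} (A : EdgeSet n) {h e} → e ∈E minus A h → ¬ (e ≡ h)
minus-≢ A {h} {e} me refl = true≢false (trans (sym me) (minus-∉ A h))

minus-∪-single : ∀ {n} (A : EdgeSet n) h → h ∈E A → A ≐ (minus A h ∪E single h)
minus-∪-single A h hA e with e ≟E h
... | yes refl rewrite single-refl e = trans hA (sym (∨-zeroʳ _))
... | no ne rewrite single-≢ ne = sym (trans (∨-identityʳ _) (∧-identityʳ (A e)))

Ends : ∀ {n} → Edge n → Fin n → Set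
Ends e v = v ≡ lo e ⊎ v ≡ hi e

Spans : ∀ {n} → Edge n → Fin n → Fin n → Set
Spans e i j = (lo e ≡ i × hi e ≡ j) ⊎ (lo e ≡ j × hi e ≡ i)

spans-sym : ∀ {n} {e : Edge n} {i j} → Spans e i j → Spans e j i
spans-sym (inj₁ x) = inj₂ x
spans-sym (inj₂ x) = inj₁ x

spans-ends : ∀ {n} {e : Edge n} {v w} → Spans e v w → Ends e v
spans-ends (inj₁ (p , _)) = inj₁ (sym p)
spans-ends (inj₂ (_ , q)) = inj₂ (sym q)

ends-spans : ∀ {n} {e : Edge n} {v} → Ends e v → ∃ λ w → Spans e v w
ends-spans {e = e} (inj₁ refl) = hi e , inj₁ (refl , refl)
ends-spans {e = e} (inj₂ refl) = lo e , inj₂ (refl , refl)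

spans-unique : ∀ {n} {e e' : Edge n} {i j} → Spans e i j → Spans e' i j → e ≡ e'
spans-unique (inj₁ (p , q)) (inj₁ (p' , q')) = edge-ext (trans p (sym p')) (trans q (sym q'))
spans-unique (inj₂ (p , q)) (inj₂ (p' , q')) = edge-ext (trans p (sym p')) (trans q (sym q'))
spans-unique {e = e} {e'} (inj₁ (p , q)) (inj₂ (p' , q')) =
  ⊥-elim (Finₚ.<-asym (lo<hi e) (subst₂ Fin._<_ (trans p' (sym q)) (trans q' (sym p)) (lo<hi e')))
spans-unique {e = e} {e'} (inj₂ (p , q)) (inj₁ (p' , q')) =
  ⊥-elim (Finₚ.<-asym (lo<hi e) (subst₂ Fin._<_ (trans p' (sym q)) (trans q' (sym p)) (lo<hi e')))

spans-other : ∀ {n} {e : Edge n} {v x y} → Spans e v x → Spans e v y → x ≡ y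
spans-other (inj₁ (_ , q)) (inj₁ (_ , q')) = trans (sym q) q'
spans-other (inj₂ (p , _)) (inj₂ (p' , _)) = trans (sym p) p'
spans-other {e = e} (inj₁ (p , _)) (inj₂ (_ , q')) = ⊥-elim (lo≢hi e (trans p (sym q')))
spans-other {e = e} (inj₂ (_ , q)) (inj₁ (p' , _)) = ⊥-elim (lo≢hi e (trans p' (sym q)))

third-endpoint : ∀ {n} (g h : Edge n) → ¬ (h ≡ g) → ∃ λ w → Ends h w × ¬ (w ≡ lo g) × ¬ (w ≡ hi g)
third-endpoint g h ne with lo h ≟ lo g | lo h ≟ hi g | hi h ≟ lo g | hi h ≟ hi g
... | no a | no b | _ | _ = lo h , inj₁ refl , a , b
... | _ | _ | no c | no d = hi h , inj₂ refl , c , d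
... | yes a | _ | yes c | _ = ⊥-elim (lo≢hi h (trans a (sym c)))
... | _ | yes b | _ | yes d = ⊥-elim (lo≢hi h (trans b (sym d)))
... | yes a | _ | no _ | yes d = ⊥-elim (ne (edge-ext a d))
... | no _ | yes b | yes c | _ = ⊥-elim (ne (spans-unique (inj₂ (b , c)) (inj₁ (refl , refl))))

adj-view : ∀ {n} (i j : Fin n) →
  (Σ (Edge n) λ e → Spans e i j × (∀ A → adj A i j ≡ A e)) ⊎ (i ≡ j × (∀ A → adj A i j ≡ false))
adj-view i j with i <ᶠ? j
... | yes p = inj₁ (edge i j p , inj₁ (refl , refl) , λ _ → refl)
... | no np with j <ᶠ? i
...   | yes q = inj₁ (edge j i q , inj₂ (refl , refl) , λ _ → refl)
...   | no nq = inj₂ (Finₚ.≤-antisym (≮⇒≥ nq) (≮⇒≥ np) , λ _ → refl)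

adj-edge : ∀ {n} (A : EdgeSet n) (e : Edge n) {i j} → Spans e i j → adj A i j ≡ A e
adj-edge A e {i} {j} sp with adj-view i j
... | inj₁ (e' , sp' , h) = trans (h A) (cong A (spans-unique sp' sp))
... | inj₂ (refl , _) with sp
...   | inj₁ (p , q) = ⊥-elim (lo≢hi e (trans p (sym q)))
...   | inj₂ (p , q) = ⊥-elim (lo≢hi e (trans p (sym q)))

adj-irrefl : ∀ {n} (A : EdgeSet n) i → adj A i i ≡ false
adj-irrefl A i with adj-view i i
... | inj₂ (_ , h) = h A
... | inj₁ (e , inj₁ (p , q) , _) = ⊥-elim (lo≢hi e (trans p (sym q)))
... | inj₁ (e , inj₂ (p , q) , _) = ⊥-elim (lo≢hi e (trans p (sym q)))

adj-true : ∀ {n} (A : EdgeSet n) {i j} → adj A i j ≡ true → Σ (Edge n) λ e → Spans e i j × e ∈E A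
adj-true A {i} {j} h with adj-view i j
... | inj₁ (e , sp , k) = e , sp , trans (sym (k A)) h
... | inj₂ (_ , k) = ⊥-elim (true≢false (trans (sym h) (k A)))

adj-sym : ∀ {n} (A : EdgeSet n) i j → adj A i j ≡ adj A j i
adj-sym A i j with adj-view i j
... | inj₁ (e , sp , k) = trans (k A) (sym (adj-edge A e {j} {i} (spans-sym {e = e} {i} {j} sp)))
... | inj₂ (refl , _) = refl

adj-cong : ∀ {n} {A B : EdgeSet n} → A ≐ B → ∀ i j → adj A i j ≡ adj B i j
adj-cong {A = A} {B} eq i j with adj-view i j
... | inj₁ (e , _ , k) = trans (k A) (trans (eq e) (sym (k B)))
... | inj₂ (_ , k) = trans (k A) (sym (k B))

eterm : ∀ {n} → EdgeSet n → Fin n → Fin n → ℕ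
eterm A i j = 𝟙 (⌊ i <ᶠ? j ⌋ ∧ adj A i j)

eSize≡ : ∀ {n} (A : EdgeSet n) → eSize A ≡ ∑ (λ i → ∑ (λ j → eterm A i j))
eSize≡ {n} A = trans (sum-allFin n _) (sum-cong-≗ (λ i → sum-allFin n (eterm A i)))

eterm-view : ∀ {n} (i j : Fin n) →
  (Σ (i Fin.< j) λ p → ∀ A → eterm A i j ≡ 𝟙 (A (edge i j p))) ⊎ (¬ (i Fin.< j) × (∀ A → eterm A i j ≡ 0))
eterm-view i j with i <ᶠ? j
... | yes p = inj₁ (p , λ _ → refl)
... | no np = inj₂ (np , λ _ → refl)

eterm-mono : ∀ {n} {A B : EdgeSet n} → A ⊆E B → ∀ i j → eterm A i j ≤ eterm B i j
eterm-mono {A = A} {B} sub i j with eterm-view i j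
... | inj₁ (p , h) rewrite h A | h B = 𝟙-mono (sub (edge i j p))
... | inj₂ (_ , h) rewrite h A | h B = ≤-refl

eSize-mono : ∀ {n} {A B : EdgeSet n} → A ⊆E B → eSize A ≤ eSize B
eSize-mono {n} {A} {B} sub = subst₂ _≤_ (sym (eSize≡ A)) (sym (eSize≡ B))
  (∑-mono n (λ i → ∑-mono n (eterm-mono sub i)))

eSize-cong : ∀ {n} {A B : EdgeSet n} → A ≐ B → eSize A ≡ eSize B
eSize-cong eq = ≤-antisym (eSize-mono (λ e h → trans (sym (eq e)) h)) (eSize-mono (λ e h → trans (eq e) h))

eSize-strict : ∀ {n} {A B : EdgeSet n} → A ⊆E B → ∀ e → e ∈E B → e ∉E A → eSize A < eSize B
eSize-strict {n} {A} {B} sub e eB eA = subst₂ _<_ (sym (eSize≡ A)) (sym (eSize≡ B))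
  (∑-mono-< n (λ i → ∑-mono n (eterm-mono sub i)) (lo e)
    (∑-mono-< n (eterm-mono sub (lo e)) (hi e) at-e))
  where
  at-e : eterm A (lo e) (hi e) < eterm B (lo e) (hi e)
  at-e with eterm-view (lo e) (hi e)
  ... | inj₁ (p , h) rewrite h A | h B | eA | eB = s≤s z≤n
  ... | inj₂ (np , _) = ⊥-elim (np (lo<hi e))

∅E : ∀ {n} → EdgeSet n
∅E _ = false

eSize-∅ : ∀ {n} → eSize (∅E {n}) ≡ 0
eSize-∅ {n} = trans (eSize≡ (∅E {n})) (∑-zero n (λ i → ∑-zero n (vanish i)))
  where
  vanish : ∀ i j → eterm ∅E i j ≡ 0
  vanish i j with eterm-view i j
  ... | inj₁ (_ , h) = h ∅E
  ... | inj₂ (_ , h) = h ∅E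

eSize-pos : ∀ {n} {A : EdgeSet n} e → e ∈E A → 1 ≤ eSize A
eSize-pos {n} {A} e h = subst (_< eSize A) (eSize-∅ {n}) (eSize-strict (λ _ ()) e h refl)

eSize-zero : ∀ {n} {A : EdgeSet n} → eSize A ≡ 0 → ∀ e → e ∉E A
eSize-zero z e = false-if (λ h → 1+n≰n (subst (1 ≤_) z (eSize-pos e h)))

eSize-witness : ∀ {n} (A : EdgeSet n) → ¬ (eSize A ≡ 0) → ∃ λ e → e ∈E A
eSize-witness {n} A nz with ∑-witness n _ (λ z → nz (trans (eSize≡ A) z))
... | i , nzi with ∑-witness n _ nzi
...   | j , nzj with eterm-view i j
...     | inj₂ (_ , h) = ⊥-elim (nzj (h A))
...     | inj₁ (p , h) = edge i j p , 𝟙≢0 (λ z → nzj (trans (h A) z))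

empty-or-edge : ∀ {n} (A : EdgeSet n) → (∀ e → e ∉E A) ⊎ (∃ λ e → e ∈E A)
empty-or-edge A with eSize A ≟ℕ 0
... | yes z = inj₁ (eSize-zero z)
... | no nz = inj₂ (eSize-witness A nz)

≐-dec : ∀ {n} (A B : EdgeSet n) → Dec (A ≐ B)
≐-dec A B with empty-or-edge (λ e → A e xor B e)
... | inj₁ none = yes (λ e → xor-false (none e))
  where
  xor-false : ∀ {a b} → a xor b ≡ false → a ≡ b
  xor-false {true} {true} _ = refl
  xor-false {false} {false} _ = refl
... | inj₂ (e , differ) = no (λ eq → true≢false (trans (sym differ) (trans (cong (A e xor_) (sym (eq e))) (xor-same (A e)))))

eSize-∪ : ∀ {n} (A B : EdgeSet n) → eSize (A ∪E B) ≤ eSize A + eSize B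
eSize-∪ {n} A B = begin
  eSize (A ∪E B)                                             ≡⟨ eSize≡ (A ∪E B) ⟩
  ∑ (λ i → ∑ (λ j → eterm (A ∪E B) i j))                     ≤⟨ ∑-mono n (λ i → ∑-mono n (λ j → split i j)) ⟩
  ∑ (λ i → ∑ (λ j → eterm A i j + eterm B i j))              ≡⟨ sum-cong-≗ (λ i → ∑-distrib-+ (eterm A i) (eterm B i)) ⟩
  ∑ (λ i → ∑ (λ j → eterm A i j) + ∑ (λ j → eterm B i j))    ≡⟨ ∑-distrib-+ (λ i → ∑ (eterm A i)) (λ i → ∑ (eterm B i)) ⟩
  ∑ (λ i → ∑ (λ j → eterm A i j)) + ∑ (λ i → ∑ (λ j → eterm B i j)) ≡⟨ sym (cong₂ _+_ (eSize≡ A) (eSize≡ B)) ⟩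
  eSize A + eSize B                                          ∎
  where
  open ≤-Reasoning
  𝟙-∨ : ∀ a b → 𝟙 (a ∨ b) ≤ 𝟙 a + 𝟙 b
  𝟙-∨ false b = ≤-refl
  𝟙-∨ true b = s≤s z≤n
  split : ∀ i j → eterm (A ∪E B) i j ≤ eterm A i j + eterm B i j
  split i j with eterm-view i j
  ... | inj₁ (p , h) rewrite h (A ∪E B) | h A | h B = 𝟙-∨ (A (edge i j p)) (B (edge i j p))
  ... | inj₂ (_ , h) rewrite h (A ∪E B) | h A | h B = z≤n

eSize-single : ∀ {n} (g : Edge n) → eSize (single g) ≤ 1
eSize-single {n} g = begin
  eSize (single g)                               ≡⟨ eSize≡ (single g) ⟩
  ∑ (λ i → ∑ (λ j → eterm (single g) i j))       ≡⟨ ∑-supported n _ (lo g) (λ i ne → ∑-zero n (off-lo i ne)) ⟩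
  ∑ (λ j → eterm (single g) (lo g) j)            ≡⟨ ∑-supported n _ (hi g) off-hi ⟩
  eterm (single g) (lo g) (hi g)                 ≤⟨ 𝟙≤1 _ ⟩
  1                                              ∎
  where
  open ≤-Reasoning
  only-g : ∀ i j → (∀ p → edge i j p ≡ g → ⊥) → eterm (single g) i j ≡ 0
  only-g i j ng with eterm-view i j
  ... | inj₂ (_ , h) = h (single g)
  ... | inj₁ (p , h) = trans (h (single g)) (cong 𝟙 (single-≢ (ng p)))
  off-lo : ∀ i → ¬ (i ≡ lo g) → ∀ j → eterm (single g) i j ≡ 0
  off-lo i ne j = only-g i j (λ p eq → ne (cong lo eq))
  off-hi : ∀ j → ¬ (j ≡ hi g) → eterm (single g) (lo g) j ≡ 0
  off-hi j ne = only-g (lo g) j (λ p eq → ne (cong hi eq))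

eSize-∪-single : ∀ {n} (A : EdgeSet n) g → eSize (A ∪E single g) ≤ suc (eSize A)
eSize-∪-single A g =
  ≤-trans (eSize-∪ A (single g)) (≤-trans (+-monoʳ-≤ (eSize A) (eSize-single g)) (≤-reflexive (+-comm (eSize A) 1)))

any-intro : ∀ n (p : Fin n → Bool) x → p x ≡ true → any p (allFin n) ≡ true
any-intro n p x px = Equivalence.to T-≡ (any⁺ p (lose (∈-allFin x) (Equivalence.from T-≡ px)))

any-elim : ∀ n (p : Fin n → Bool) → any p (allFin n) ≡ true → ∃ λ x → p x ≡ true
any-elim n p h with satisfied (any⁻ p (allFin n) (Equivalence.from T-≡ h))
... | x , px = x , Equivalence.to T-≡ px

incident-intro : ∀ {n} (A : EdgeSet n) e v → e ∈E A → Ends e v → incident A v ≡ true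
incident-intro {n} A e v h en with ends-spans {e = e} en
... | w , sp = any-intro n (adj A v) w (trans (adj-edge A e sp) h)

incident-elim : ∀ {n} (A : EdgeSet n) v → incident A v ≡ true → Σ (Edge n) λ e → e ∈E A × Ends e v
incident-elim {n} A v h with any-elim n (adj A v) h
... | w , k with adj-true A {v} {w} k
...   | e , sp , ae = e , ae , spans-ends {e = e} {v} {w} sp

incident-mono : ∀ {n} {A B : EdgeSet n} → A ⊆E B → ∀ v → incident A v ≡ true → incident B v ≡ true
incident-mono {A = A} {B} sub v h with incident-elim A v h
... | e , ae , en = incident-intro B e v (sub e ae) en

incident-cong : ∀ {n} {A B : EdgeSet n} → A ≐ B → ∀ v → incident A v ≡ incident B v
incident-cong {n} eq v = cong or (map-cong (adj-cong eq v) (allFin n))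

BothInc : ∀ {n} → EdgeSet n → EdgeSet n → Fin n → Set
BothInc A B v = incident A v ≡ true × incident B v ≡ true

commonV≡ : ∀ {n} (A B : EdgeSet n) → commonV A B ≡ ∑ (λ v → 𝟙 (incident A v ∧ incident B v))
commonV≡ {n} A B = sum-allFin n _

commonV-cong : ∀ {n} {A A' B B' : EdgeSet n} → A ≐ A' → B ≐ B' → commonV A B ≡ commonV A' B'
commonV-cong {n} {A} {A'} {B} {B'} p q =
  trans (commonV≡ A B)
    (trans (sum-cong-≗ (λ v → cong₂ (λ a b → 𝟙 (a ∧ b)) (incident-cong p v) (incident-cong q v)))
      (sym (commonV≡ A' B')))

commonE-cong : ∀ {n} {A A' B B' : EdgeSet n} → A ≐ A' → B ≐ B' → commonE A B ≡ commonE A' B'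
commonE-cong p q = eSize-cong (λ e → cong₂ _∧_ (p e) (q e))

commonV-edge : ∀ {n} (A B : EdgeSet n) g → (∀ v → Ends g v → BothInc A B v) → 2 ≤ commonV A B
commonV-edge {n} A B g both = subst (2 ≤_) (sym (commonV≡ A B))
  (subst (_≤ ∑ both?) (cong₂ _+_ (common (lo g) (inj₁ refl)) (common (hi g) (inj₂ refl)))
    (∑-two n both? (lo g) (hi g) (λ eq → lo≢hi g (sym eq))))
  where
  both? : Fin n → ℕ
  both? v = 𝟙 (incident A v ∧ incident B v)
  common : ∀ v → Ends g v → 𝟙 (incident A v ∧ incident B v) ≡ 1
  common v en with both v en
  ... | p , q rewrite p | q = refl

commonV-two-edges : ∀ {n} (A B : EdgeSet n) (g h : Edge n) → ¬ (h ≡ g) →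
  (∀ v → Ends g v → BothInc A B v) → (∀ v → Ends h v → BothInc A B v) → 3 ≤ commonV A B
commonV-two-edges {n} A B g h ne bg bh with third-endpoint g h ne
... | w , hw , nlo , nhi = subst (3 ≤_) (sym (commonV≡ A B))
  (subst (_≤ ∑ both?) (cong₂ _+_ (cong₂ _+_ (common (bg _ (inj₁ refl))) (common (bg _ (inj₂ refl)))) (common (bh w hw)))
    (∑-three n both? (lo g) (hi g) w (λ eq → lo≢hi g (sym eq)) nlo nhi))
  where
  both? : Fin n → ℕ
  both? v = 𝟙 (incident A v ∧ incident B v)
  common : ∀ {v} → BothInc A B v → 𝟙 (incident A v ∧ incident B v) ≡ 1
  common (p , q) rewrite p | q = refl

degsum : ∀ {n} → EdgeSet n → ℕ
degsum {n} A = ∑ (λ i → ∑ (λ j → 𝟙 (adj A i j)))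

degree≡ : ∀ {n} (A : EdgeSet n) v → degree A v ≡ ∑ (λ w → 𝟙 (adj A v w))
degree≡ {n} A v = sum-allFin n _

handshake : ∀ {n} (A : EdgeSet n) → degsum A ≡ eSize A + eSize A
handshake {n} A = begin
  degsum A                                                      ≡⟨ sum-cong-≗ (λ i → sum-cong-≗ (both-orders i)) ⟩
  ∑ (λ i → ∑ (λ j → eterm A i j + eterm A j i))                 ≡⟨ sum-cong-≗ (λ i → ∑-distrib-+ (eterm A i) (λ j → eterm A j i)) ⟩
  ∑ (λ i → ∑ (eterm A i) + ∑ (λ j → eterm A j i))               ≡⟨ ∑-distrib-+ (λ i → ∑ (eterm A i)) (λ i → ∑ (λ j → eterm A j i)) ⟩
  ∑ (λ i → ∑ (eterm A i)) + ∑ (λ i → ∑ (λ j → eterm A j i))     ≡⟨ cong (∑ (λ i → ∑ (eterm A i)) +_) (∑-comm (λ i j → eterm A j i)) ⟩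
  ∑ (λ i → ∑ (eterm A i)) + ∑ (λ i → ∑ (eterm A i))             ≡⟨ sym (cong₂ _+_ (eSize≡ A) (eSize≡ A)) ⟩
  eSize A + eSize A                                             ∎
  where
  open ≡-Reasoning
  -- the edge {i,j} is counted once, under the ordered pair (min, max)
  both-orders : ∀ i j → 𝟙 (adj A i j) ≡ eterm A i j + eterm A j i
  both-orders i j with eterm-view i j | eterm-view j i
  ... | inj₁ (p , _) | inj₁ (q , _) = ⊥-elim (Finₚ.<-asym p q)
  ... | inj₁ (p , h) | inj₂ (_ , h') rewrite h A | h' A =
         trans (cong 𝟙 (adj-edge A (edge i j p) {i} {j} (inj₁ (refl , refl)))) (sym (+-identityʳ _))
  ... | inj₂ (_ , h) | inj₁ (q , h') rewrite h A | h' A =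
         cong 𝟙 (trans (adj-sym A i j) (adj-edge A (edge j i q) {j} {i} (inj₁ (refl , refl))))
  ... | inj₂ (np , h) | inj₂ (nq , h') rewrite h A | h' A
         | Finₚ.≤-antisym (≮⇒≥ nq) (≮⇒≥ np) = cong 𝟙 (adj-irrefl A j)

-- Minimum degree 2 and its consequence for copies of H.

MinDeg2 : ∀ {m} → EdgeSet m → Set
MinDeg2 {m} hE = ∀ v → 2 ≤ degree hE v

other-neighbour : ∀ {m} (hE : EdgeSet m) → MinDeg2 hE → ∀ a b → adj hE a b ≡ true →
                  ∃ λ c → ¬ (c ≡ b) × adj hE a c ≡ true
other-neighbour {m} hE md a b ab with ∑-witness m (without b nbr) rest≢0
  where
  nbr : Fin m → ℕ
  nbr w = 𝟙 (adj hE a w)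
  rest≢0 : ¬ (∑ (without b nbr) ≡ 0)
  rest≢0 z = 1+n≰n (begin
    2                                ≤⟨ md a ⟩
    degree hE a                      ≡⟨ degree≡ hE a ⟩
    ∑ nbr                            ≡⟨ ∑-split m nbr b ⟩
    nbr b + ∑ (without b nbr)        ≡⟨ cong₂ _+_ (cong 𝟙 ab) z ⟩
    1                                ∎)
    where open ≤-Reasoning
... | c , nz with c ≟ b
...   | yes _ = ⊥-elim (nz refl)
...   | no c≢b = c , c≢b , 𝟙≢0 nz

-- Copies of H.  An isomorphism φ transports adjacency, so a copy of H has
-- exactly e_H edges.

iso-cong : ∀ {m n} (hE : EdgeSet m) {A B : EdgeSet n} → A ≐ B → IsoToH hE A → IsoToH hE B
iso-cong hE eq (φ , inj , fw , bw) =
  φ , inj , (λ e h → fw e (trans (eq e) h)) , (λ e' h e mp → trans (sym (eq e)) (bw e' h e mp))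

module Iso {m n} (hE : EdgeSet m) (A : EdgeSet n) (iso : IsoToH hE A) where
  φ : Fin m → Fin n
  φ = proj₁ iso
  inj : ∀ {a b} → φ a ≡ φ b → a ≡ b
  inj = proj₁ (proj₂ iso)
  fwd : ∀ e → e ∈E A → ∃ λ e' → e' ∈E hE × Maps φ e' e
  fwd = proj₁ (proj₂ (proj₂ iso))
  bwd : ∀ e' → e' ∈E hE → ∀ e → Maps φ e' e → e ∈E A
  bwd = proj₂ (proj₂ (proj₂ iso))

  spans-maps : ∀ {e' : Edge m} {e : Edge n} {a b} → Spans e' a b → Spans e (φ a) (φ b) → Maps φ e' e
  spans-maps (inj₁ (refl , refl)) (inj₁ (r , s)) = inj₁ (sym r , sym s)
  spans-maps (inj₁ (refl , refl)) (inj₂ (r , s)) = inj₂ (sym s , sym r)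
  spans-maps (inj₂ (refl , refl)) (inj₁ (r , s)) = inj₂ (sym s , sym r)
  spans-maps (inj₂ (refl , refl)) (inj₂ (r , s)) = inj₁ (sym r , sym s)

  maps-spans : ∀ {e' : Edge m} {e : Edge n} {a b} → Maps φ e' e → Spans e (φ a) (φ b) → Spans e' a b
  maps-spans (inj₁ (p , q)) (inj₁ (r , s)) = inj₁ (inj (trans p r) , inj (trans q s))
  maps-spans (inj₁ (p , q)) (inj₂ (r , s)) = inj₂ (inj (trans p r) , inj (trans q s))
  maps-spans (inj₂ (p , q)) (inj₁ (r , s)) = inj₂ (inj (trans p s) , inj (trans q r))
  maps-spans (inj₂ (p , q)) (inj₂ (r , s)) = inj₁ (inj (trans p s) , inj (trans q r))

  maps-preimage : ∀ {e' : Edge m} {e : Edge n} {v w} → Maps φ e' e → Spans e v w →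
    Σ (Fin m) λ a → Σ (Fin m) λ b → φ a ≡ v × φ b ≡ w × Spans e' a b
  maps-preimage {e'} (inj₁ (p , q)) (inj₁ (r , s)) = lo e' , hi e' , trans p r , trans q s , inj₁ (refl , refl)
  maps-preimage {e'} (inj₁ (p , q)) (inj₂ (r , s)) = hi e' , lo e' , trans q s , trans p r , inj₂ (refl , refl)
  maps-preimage {e'} (inj₂ (p , q)) (inj₁ (r , s)) = hi e' , lo e' , trans q r , trans p s , inj₂ (refl , refl)
  maps-preimage {e'} (inj₂ (p , q)) (inj₂ (r , s)) = lo e' , hi e' , trans p s , trans q r , inj₁ (refl , refl)

  adj-iso : ∀ a b → adj A (φ a) (φ b) ≡ adj hE a b
  adj-iso a b = bool-ext to from
    where
    from : adj hE a b ≡ true → adj A (φ a) (φ b) ≡ true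
    from h with adj-true hE {a} {b} h
    ... | e' , sp' , he' with adj-view (φ a) (φ b)
    ...   | inj₁ (e , sp , k) = trans (k A) (bwd e' he' e (spans-maps {e'} {e} sp' sp))
    ...   | inj₂ (eq , _) rewrite inj eq = ⊥-elim (true≢false (trans (sym h) (adj-irrefl hE b)))
    to : adj A (φ a) (φ b) ≡ true → adj hE a b ≡ true
    to h with adj-true A {φ a} {φ b} h
    ... | e , sp , ae with fwd e ae
    ...   | e' , he' , mp = trans (adj-edge hE e' (maps-spans {e'} {e} mp sp)) he'

  image : ∀ v w → adj A v w ≡ true → ∃ λ a → φ a ≡ v
  image v w h with adj-true A {v} {w} h
  ... | e , sp , ae with fwd e ae
  ...   | e' , _ , mp with maps-preimage {e'} {e} {v} {w} mp sp
  ...     | a , _ , p , _ = a , p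

  degsum-iso : degsum A ≡ degsum hE
  degsum-iso = begin
    degsum A                                         ≡⟨ ∑-reindex φ inj _ outer ⟩
    ∑ (λ u → ∑ (λ j → 𝟙 (adj A (φ u) j)))            ≡⟨ sum-cong-≗ (λ u → ∑-reindex φ inj _ (inner u)) ⟩
    ∑ (λ u → ∑ (λ w → 𝟙 (adj A (φ u) (φ w))))        ≡⟨ sum-cong-≗ (λ u → sum-cong-≗ (λ w → cong 𝟙 (adj-iso u w))) ⟩
    degsum hE                                        ∎
    where
    open ≡-Reasoning
    outer : ∀ v → ¬ (∑ (λ j → 𝟙 (adj A v j)) ≡ 0) → ∃ λ a → φ a ≡ v
    outer v nz with ∑-witness n _ nz
    ... | j , nzj = image v j (𝟙≢0 nzj)
    inner : ∀ u w → ¬ (𝟙 (adj A (φ u) w) ≡ 0) → ∃ λ a → φ a ≡ w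
    inner u w nz = image w (φ u) (trans (adj-sym A w (φ u)) (𝟙≢0 nz))

  eSize-iso : eSize A ≡ eSize hE
  eSize-iso = +-cancel-double (trans (sym (handshake A)) (trans degsum-iso (handshake hE)))
    where
    +-cancel-double : ∀ {a b} → a + a ≡ b + b → a ≡ b
    +-cancel-double {a} {b} h = *-cancelˡ-≡ a b 2 (trans (cong (a +_) (+-identityʳ a)) (trans h (sym (cong (b +_) (+-identityʳ b)))))

  other-edge : MinDeg2 hE → ∀ e v → e ∈E A → Ends e v → Σ (Edge n) λ e₂ → e₂ ∈E A × ¬ (e₂ ≡ e) × Ends e₂ v
  other-edge md e v ae en with ends-spans {e = e} {v} en
  ... | w , sp with fwd e ae
  ...   | e' , he' , mp with maps-preimage {e'} {e} {v} {w} mp sp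
  ...     | a , b , refl , refl , sp' with other-neighbour hE md a b (trans (adj-edge hE e' sp') he')
  ...       | c , c≢b , ac with adj-true A {φ a} {φ c} (trans (adj-iso a c) ac)
  ...         | e₂ , sp₂ , ae₂ = e₂ , ae₂ , e₂≢e , spans-ends {e = e₂} {φ a} {φ c} sp₂
    where
    e₂≢e : ¬ (e₂ ≡ e)
    e₂≢e refl = c≢b (inj (spans-other {e = e} sp₂ sp))

  minus-incident : MinDeg2 hE → ∀ h v → h ∈E A → Ends h v → incident (minus A h) v ≡ true
  minus-incident md h v ah en with other-edge md h v ah en
  ... | e₂ , ae₂ , ne , en₂ = incident-intro (minus A h) e₂ v (minus-∈ A ae₂ ne) en₂

-- A regular, strictly 2-balanced graph H without isolated vertices has
-- minimum degree at least 2: otherwise H is a perfect matching, and removing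
-- one edge e₀ gives a subgraph F violating strict 2-balancedness.

-- For a matching with x + 2 edges (hence 2x + 4 vertices) and F = H - e₀,
-- both sides of the balancedness inequality equal 2x(x+1).
matching-arith : ∀ x eF vF → x ≤ eF ∸ 1 → vF ∸ 2 ≤ x + x →
  (eF ∸ 1) * (x + suc (suc x)) < suc x * (vF ∸ 2) → ⊥
matching-arith x eF vF heF hvF lt = <-irrefl refl (begin-strict
  x * (x + suc (suc x))          ≤⟨ *-monoˡ-≤ (x + suc (suc x)) heF ⟩
  (eF ∸ 1) * (x + suc (suc x))   <⟨ lt ⟩
  suc x * (vF ∸ 2)               ≤⟨ *-monoʳ-≤ (suc x) hvF ⟩
  suc x * (x + x)                ≡⟨ both-sides x ⟩
  x * (x + suc (suc x))          ∎)
  where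
  open ≤-Reasoning
  open +-*-Solver
  both-sides : ∀ x → suc x * (x + x) ≡ x * (x + suc (suc x))
  both-sides = solve 1 (λ x → (con 1 :+ x) :* (x :+ x) := x :* (x :+ (con 2 :+ x))) refl

degsum-regular : ∀ {m} (hE : EdgeSet m) r → (∀ v → degree hE v ≡ r) → degsum hE ≡ m * r
degsum-regular {m} hE r reg = trans (sum-cong-≗ (λ v → trans (sym (degree≡ hE v)) (reg v))) (∑-const m r)

module PerfectMatching {m} (hE : EdgeSet m) (noiso : NoIsolated hE) (reg : ∀ v → degree hE v ≡ 1)
                       (sb : Strictly2Balanced hE) (e₀ : Edge m) (he₀ : e₀ ∈E hE) where
  F : EdgeSet m
  F = minus hE e₀

  -- the endpoints of e₀ have degree 1, so they are not vertices of F
  endpoint-not-in-F : ∀ v x → Spans e₀ v x → incident F v ≡ false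
  endpoint-not-in-F v x sp = false-if λ inc → not-in (incident-elim F v inc)
    where
    not-in : Σ (Edge m) (λ e → e ∈E F × Ends e v) → ⊥
    not-in (e , eF , en) with ends-spans {e = e} {v} en
    ... | w , spw = 1+n≰n (begin
      2                                   ≡⟨ cong₂ _+_ (cong 𝟙 (trans (adj-edge hE e₀ sp) he₀))
                                                        (cong 𝟙 (trans (adj-edge hE e spw) (minus-⊆ hE e₀ e eF))) ⟨
      𝟙 (adj hE v x) + 𝟙 (adj hE v w)     ≤⟨ ∑-two m (λ w → 𝟙 (adj hE v w)) x w w≢x ⟩
      ∑ (λ w → 𝟙 (adj hE v w))            ≡⟨ degree≡ hE v ⟨
      degree hE v                         ≡⟨ reg v ⟩
      1                                   ∎)
      where
      open ≤-Reasoning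
      w≢x : ¬ (w ≡ x)
      w≢x refl = minus-≢ hE {e₀} {e} eF (spans-unique spw sp)

  -- every other vertex lies on an edge of H, which is not e₀
  other-in-F : ∀ x → ¬ (x ≡ lo e₀) → ¬ (x ≡ hi e₀) → incident F x ≡ true
  other-in-F x nlo nhi with incident-elim hE x (noiso x)
  ... | e , he , en = incident-intro F e x (minus-∈ hE he e≢e₀) en
    where
    e≢e₀ : ¬ (e ≡ e₀)
    e≢e₀ refl = [ nlo , nhi ]′ en

  vSize-F : suc (suc (vSize F)) ≡ m
  vSize-F = begin
    suc (suc (vSize F))                           ≡⟨ cong (λ k → suc (suc k)) (trans (sum-allFin m _) (sum-cong-≗ F-vertex)) ⟩
    1 + (1 + ∑ (without hi₀ (without lo₀ one)))   ≡⟨ cong (λ k → 1 + (k + ∑ (without hi₀ (without lo₀ one)))) (without-≢ one (λ e → lo≢hi e₀ (sym e))) ⟨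
    1 + (without lo₀ one hi₀ + ∑ (without hi₀ (without lo₀ one))) ≡⟨ cong (1 +_) (∑-split m (without lo₀ one) hi₀) ⟨
    1 + ∑ (without lo₀ one)                       ≡⟨ ∑-split m one lo₀ ⟨
    ∑ one                                         ≡⟨ trans (∑-const m 1) (*-identityʳ m) ⟩
    m                                             ∎
    where
    open ≡-Reasoning
    lo₀ hi₀ : Fin m
    lo₀ = lo e₀
    hi₀ = hi e₀
    one : Fin m → ℕ
    one _ = 1
    F-vertex : ∀ x → 𝟙 (incident F x) ≡ without hi₀ (without lo₀ one) x
    F-vertex x with x ≟ lo₀ | x ≟ hi₀
    ... | yes refl | yes eq = ⊥-elim (lo≢hi e₀ eq)
    ... | yes refl | no _ = cong 𝟙 (endpoint-not-in-F lo₀ hi₀ (inj₁ (refl , refl)))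
    ... | no _ | yes refl = cong 𝟙 (endpoint-not-in-F hi₀ lo₀ (inj₂ (refl , refl)))
    ... | no nlo | no nhi = cong 𝟙 (other-in-F x nlo nhi)

  eSize-F : eSize hE ≤ suc (eSize F)
  eSize-F = ≤-trans (eSize-mono H⊆F+e₀) (eSize-∪-single F e₀)
    where
    H⊆F+e₀ : hE ⊆E (F ∪E single e₀)
    H⊆F+e₀ e he with e ≟E e₀
    ... | yes refl = ∨-introʳ (F e₀) (single-refl e₀)
    ... | no ne = ∨-introˡ (single e₀ e) (minus-∈ hE he ne)

  e-form : ∀ {k} → 3 ≤ k → ∃ λ x → 1 ≤ x × k ≡ suc (suc x)
  e-form (s≤s (s≤s 1≤x)) = _ , 1≤x , refl

  v≡2e : m ≡ eSize hE + eSize hE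
  v≡2e = trans (sym (*-identityʳ m)) (trans (sym (degsum-regular hE 1 reg)) (handshake hE))

  absurd : ⊥
  absurd with e-form (proj₁ (proj₂ sb))
  ... | x , 1≤x , eH =
    matching-arith x (eSize F) (vSize F) x≤eF∸1 (≤-reflexive (cong (_∸ 2) vF≡)) balanced
    where
    vF≡ : vSize F ≡ suc (suc (x + x))
    vF≡ = suc-injective (suc-injective (trans vSize-F (trans v≡2e
            (trans (cong₂ _+_ eH eH) (cong suc (cong suc (trans (+-suc x (suc x)) (cong suc (+-suc x x)))))))))
    x≤eF∸1 : x ≤ eSize F ∸ 1
    x≤eF∸1 = ∸-monoˡ-≤ 1 (s≤s⁻¹ (subst (_≤ suc (eSize F)) eH eSize-F))
      where open import Data.Nat using (s≤s⁻¹)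
    3≤vF : 3 ≤ vSize F
    3≤vF = subst (3 ≤_) (sym vF≡) (s≤s (s≤s (≤-trans 1≤x (m≤m+n x x))))
    balanced : (eSize F ∸ 1) * (x + suc (suc x)) < suc x * (vSize F ∸ 2)
    balanced = subst (λ M → (eSize F ∸ 1) * (M ∸ 2) < suc x * (vSize F ∸ 2)) (trans v≡2e (cong₂ _+_ eH eH))
      (subst (λ E → (eSize F ∸ 1) * (m ∸ 2) < (E ∸ 1) * (vSize F ∸ 2)) eH
        (proj₂ (proj₂ sb) F (minus-⊆ hE e₀) (e₀ , he₀ , minus-∉ hE e₀) 3≤vF))

mindeg2 : ∀ {m} (hE : EdgeSet m) → NoIsolated hE → Regular hE → Strictly2Balanced hE → MinDeg2 hE
mindeg2 {m} hE noiso (r , reg) sb with r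
... | suc (suc r') = λ v → subst (2 ≤_) (sym (reg v)) (s≤s (s≤s z≤n))
... | suc zero with eSize-witness hE (λ z → 1+n≰n (subst (1 ≤_) z (≤-trans (s≤s z≤n) (proj₁ (proj₂ sb)))))
...   | e₀ , he₀ = ⊥-elim (PerfectMatching.absurd hE noiso reg sb e₀ he₀)
mindeg2 {m} hE noiso (r , reg) sb | zero = λ v → ⊥-elim (isolated v (any-elim m (adj hE v) (noiso v)))
  where
  isolated : ∀ v → (∃ λ w → adj hE v w ≡ true) → ⊥
  isolated v (w , h) = 1+n≰n (subst (1 ≤_) (trans (sym (degree≡ hE v)) (reg v))
    (≤-trans (≤-reflexive (cong 𝟙 (sym h))) (∑-point m (λ w → 𝟙 (adj hE v w)) w)))

⊆-eSize-≐ : ∀ {n} {A B : EdgeSet n} → A ⊆E B → eSize B ≤ eSize A → A ≐ B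
⊆-eSize-≐ {A = A} {B} sub le e = bool-ext (sub e) back
  where
  back : e ∈E B → e ∈E A
  back eB with A e in eA
  ... | true = refl
  ... | false = ⊥-elim (<⇒≱ (eSize-strict sub e eB eA) le)

cancel-edge : ∀ {n} {A B : EdgeSet n} x → x ∉E A → (A ∪E single x) ≐ B → A ≐ minus B x
cancel-edge {A = A} {B} x xA eq e with e ≟E x
... | yes refl = trans xA (sym (minus-∉ B x))
... | no ne = bool-ext (λ ae → minus-∈ B (trans (sym (eq e)) (∨-introˡ (single x e) ae)) ne)
                       (λ me → [ (λ ae → ae) , (λ s → ⊥-elim (ne (single-true s))) ]′
                                 (∨-elim (trans (eq e) (minus-⊆ B x e me))))

Meet : ∀ {n} → EdgeSet n → EdgeSet n → Set
Meet A B = ∃ λ e → e ∈E A × e ∈E B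

meet? : ∀ {n} (A B : EdgeSet n) → Dec (Meet A B)
meet? A B with empty-or-edge (A ∩E B)
... | inj₂ (e , h) = yes (e , ∧-elim {A e} h)
... | inj₁ none = no λ (e , ae , be) → true≢false (trans (sym (∧-intro ae be)) (none e))

largest-below : (Q : ℕ → Set) → (∀ i → Dec (Q i)) → ∀ j →
  (Σ ℕ λ k → k < j × Q k × (∀ i → k < i → i < j → ¬ Q i)) ⊎ (∀ i → i < j → ¬ Q i)
largest-below Q Q? zero = inj₂ (λ i ())
largest-below Q Q? (suc j) with Q? j
... | yes q = inj₁ (j , ≤-refl , q , λ i j<i i<1+j _ → <⇒≱ j<i (s≤s⁻¹ i<1+j))
... | no ¬q with largest-below Q Q? j
...   | inj₁ (k , k<j , qk , above) = inj₁ (k , m≤n⇒m≤1+n k<j , qk , extend)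
  where
  extend : ∀ i → k < i → i < suc j → ¬ Q i
  extend i k<i i<1+j with m≤n⇒m<n∨m≡n (s≤s⁻¹ i<1+j)
  ... | inj₁ i<j = above i k<i i<j
  ... | inj₂ refl = ¬q
...   | inj₂ none = inj₂ extend
  where
  extend : ∀ i → i < suc j → ¬ Q i
  extend i i<1+j with m≤n⇒m<n∨m≡n (s≤s⁻¹ i<1+j)
  ... | inj₁ i<j = none i i<j
  ... | inj₂ refl = ¬q

module Copy {m n} (hE : EdgeSet m) (md : MinDeg2 hE) (G : EdgeSet n) (g : Edge n) (lamG : InΛ1 hE g G) where
  K : EdgeSet n
  K = G ∪E single g

  iso : IsoToH hE K
  iso = proj₂ lamG

  eSize-K : eSize K ≡ eSize hE
  eSize-K = Iso.eSize-iso hE K iso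

  g∈K : g ∈E K
  g∈K = ∨-introʳ (G g) (single-refl g)

  G⊆K : G ⊆E K
  G⊆K e h = ∨-introˡ (single g e) h

  eSize-G : eSize G < eSize hE
  eSize-G = subst (eSize G <_) eSize-K (eSize-strict G⊆K g g∈K (proj₁ lamG))

  g-touches-G : ∀ v → Ends g v → incident G v ≡ true
  g-touches-G v en = incident-mono K-g⊆G v (Iso.minus-incident hE K iso md g v g∈K en)
    where
    K-g⊆G : minus K g ⊆E G
    K-g⊆G e me = [ (λ ge → ge) , (λ s → ⊥-elim (minus-≢ K {g} {e} me (single-true s))) ]′ (∨-elim (minus-⊆ K g e me))

module Prefix {n} (f : Edge n) where
  P : (ℕ → EdgeSet n) → ℕ → EdgeSet n
  P = prefixU f

  anyBelow-intro : ∀ j p i → i < j → p i ≡ true → anyBelow j p ≡ true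
  anyBelow-intro (suc j) p i i<1+j h with m≤n⇒m<n∨m≡n (s≤s⁻¹ i<1+j)
  ... | inj₁ i<j = ∨-introˡ (p j) (anyBelow-intro j p i i<j h)
  ... | inj₂ refl = ∨-introʳ (anyBelow j p) h

  anyBelow-elim : ∀ j p → anyBelow j p ≡ true → ∃ λ i → i < j × p i ≡ true
  anyBelow-elim (suc j) p h with ∨-elim {anyBelow j p} h
  ... | inj₁ h' with anyBelow-elim j p h'
  ...   | i , i<j , q = i , m≤n⇒m≤1+n i<j , q
  anyBelow-elim (suc j) p h | inj₂ h' = j , ≤-refl , h'

  anyBelow-cong : ∀ j p q → (∀ i → i < j → p i ≡ q i) → anyBelow j p ≡ anyBelow j q
  anyBelow-cong zero p q h = refl
  anyBelow-cong (suc j) p q h =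
    cong₂ _∨_ (anyBelow-cong j p q (λ i i<j → h i (m≤n⇒m≤1+n i<j))) (h j ≤-refl)

  P-f : ∀ S j → f ∈E P S j
  P-f S j rewrite single-refl f = refl

  P-intro : ∀ S j i e → i < j → e ∈E S i → e ∈E P S j
  P-intro S j i e i<j h = ∨-introʳ (single f e) (anyBelow-intro j (λ i → S i e) i i<j h)

  P-elim : ∀ S j e → e ∈E P S j → e ≡ f ⊎ ∃ λ i → i < j × e ∈E S i
  P-elim S j e h with ∨-elim {single f e} h
  ... | inj₁ s = inj₁ (single-true s)
  ... | inj₂ a = inj₂ (anyBelow-elim j (λ i → S i e) a)

  P₀-elim : ∀ S e → e ∈E P S 0 → e ≡ f
  P₀-elim S e h with P-elim S 0 e h
  ... | inj₁ eq = eq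

  P-mono : ∀ S j j' → j ≤ j' → P S j ⊆E P S j'
  P-mono S j j' le e h with P-elim S j e h
  ... | inj₁ refl = P-f S j'
  ... | inj₂ (i , i<j , h') = P-intro S j' i e (<-≤-trans i<j le) h'

  P-cong : ∀ S S' j → (∀ i → i < j → S i ≐ S' i) → P S j ≐ P S' j
  P-cong S S' j h e = cong (single f e ∨_) (anyBelow-cong j _ _ (λ i i<j → h i i<j e))

-- Sequences of copies.  Position j of a sequence consists of a graph S_j and
-- an edge a_j (its attachment) such that S_j ∪ {a_j} is a copy of H.
module Sequences {m n} (hE : EdgeSet m) (md : MinDeg2 hE) (f : Edge n) (Gr : EdgeSet n) where
  open Prefix f public

  copyAt : (ℕ → EdgeSet n) → (ℕ → Edge n) → ℕ → EdgeSet n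
  copyAt S a j = S j ∪E single (a j)

  record Attached (S : ℕ → EdgeSet n) (a : ℕ → Edge n) (j : ℕ) : Set where
    field
      attach : a j ∈E P S j
      copy : InΛ1 hE (a j) (S j)
      inGr : S j ⊆E Gr
  open Attached public

  TreeLike : (ℕ → EdgeSet n) → ℕ → Set
  TreeLike S j = commonV (S j) (P S j) ≡ 2 × commonE (S j) (P S j) ≡ 0

  tree-like? : ∀ S j → Dec (TreeLike S j)
  tree-like? S j = (commonV (S j) (P S j) ≟ℕ 2) ×-dec (commonE (S j) (P S j) ≟ℕ 0)

  Collapse : (ℕ → EdgeSet n) → (ℕ → Edge n) → ℕ → ℕ → Set
  Collapse S a t k = copyAt S a t ≐ copyAt S a k

  NoCollapse : (ℕ → EdgeSet n) → (ℕ → Edge n) → ℕ → Set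
  NoCollapse S a t = ∀ k → k < t → Collapse S a t k → ⊥

  tree-like-disjoint : ∀ S j → TreeLike S j → ∀ e → e ∈E S j → e ∈E P S j → ⊥
  tree-like-disjoint S j (_ , noE) e p q = true≢false (trans (sym (∧-intro p q)) (eSize-zero noE e))

  f∉tree-like : ∀ S j → TreeLike S j → f ∉E S j
  f∉tree-like S j tr = false-if (λ fS → tree-like-disjoint S j tr f fS (P-f S j))

  copy-in-prefix : ∀ S a k q → Attached S a k → k < q → copyAt S a k ⊆E P S q
  copy-in-prefix S a k q att k<q e h with ∨-elim {S k e} h
  ... | inj₁ se = P-intro S q k e k<q se
  ... | inj₂ s = subst (_∈E P S q) (sym (single-true s)) (P-mono S k q (<⇒≤ k<q) (a k) (attach att))

  not-in-earlier-copy : ∀ S a k q → TreeLike S q → Attached S a k → k < q →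
    ∀ e → e ∈E S q → e ∈E copyAt S a k → ⊥
  not-in-earlier-copy S a k q tr att k<q e eq ek =
    tree-like-disjoint S q tr e eq (copy-in-prefix S a k q att k<q e ek)

  same-position : ∀ S t → (∀ i → i < t → TreeLike S i) → ∀ k₁ k₂ → k₁ < t → k₂ < t →
    ∀ e → e ∈E S k₁ → e ∈E S k₂ → k₁ ≡ k₂
  same-position S t tr k₁ k₂ k₁<t k₂<t e h₁ h₂ with <-cmp k₁ k₂
  ... | tri≈ _ eq _ = eq
  ... | tri< lt _ _ = ⊥-elim (tree-like-disjoint S k₂ (tr k₂ k₂<t) e h₂ (P-intro S k₂ k₁ e lt h₁))
  ... | tri> _ _ gt = ⊥-elim (tree-like-disjoint S k₁ (tr k₁ k₁<t) e h₁ (P-intro S k₁ k₂ e gt h₂))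

  -- position 0 is attached at f, so it meets {f} exactly in the endpoints of f
  tree-like-0 : ∀ S a → Attached S a 0 → TreeLike S 0
  tree-like-0 S a att = ≤-antisym atMost2 (commonV-edge (S 0) (P S 0) f bothInc) , noCommonEdge
    where
    a₀≡f : a 0 ≡ f
    a₀≡f = P₀-elim S (a 0) (attach att)
    f∉S₀ : f ∉E S 0
    f∉S₀ = subst (_∉E S 0) a₀≡f (proj₁ (copy att))
    noCommonEdge : commonE (S 0) (P S 0) ≡ 0
    noCommonEdge = n≤0⇒n≡0 (≤-trans (eSize-mono {B = ∅E} none) (≤-reflexive (eSize-∅ {n})))
      where
      none : (S 0 ∩E P S 0) ⊆E ∅E
      none e h with ∧-elim {S 0 e} h
      ... | se , pe rewrite P₀-elim S e pe = ⊥-elim (true≢false (trans (sym se) f∉S₀))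
    bothInc : ∀ v → Ends f v → BothInc (S 0) (P S 0) v
    bothInc v en = Copy.g-touches-G hE md (S 0) (a 0) (copy att) v (subst (λ z → Ends z v) (sym a₀≡f) en) ,
                   incident-intro (P S 0) f v (P-f S 0) en
    -- every common vertex is an endpoint of f, the only edge of P S 0
    onlyEnds : ∀ v → ¬ (v ≡ lo f) → ¬ (v ≡ hi f) → 𝟙 (incident (S 0) v ∧ incident (P S 0) v) ≡ 0
    onlyEnds v nlo nhi with incident (P S 0) v in inc
    ... | false rewrite ∧-zeroʳ (incident (S 0) v) = refl
    ... | true with incident-elim (P S 0) v inc
    ...   | e , pe , en rewrite P₀-elim S e pe = ⊥-elim ([ nlo , nhi ]′ en)
    atMost2 : commonV (S 0) (P S 0) ≤ 2
    atMost2 = ≤-trans (≤-reflexive (commonV≡ (S 0) (P S 0)))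
      (≤-trans (∑-supported₂ n (λ v → 𝟙 (incident (S 0) v ∧ incident (P S 0) v)) (lo f) (hi f) onlyEnds)
        (+-mono-≤ (𝟙≤1 (incident (S 0) (lo f) ∧ incident (P S 0) (lo f))) (𝟙≤1 (incident (S 0) (hi f) ∧ incident (P S 0) (hi f)))))

  attach-unique : ∀ S k g h → TreeLike S k → g ∈E P S k → h ∈E P S k →
    (∀ v → Ends g v → incident (S k) v ≡ true) → (∀ v → Ends h v → incident (S k) v ≡ true) → h ≡ g
  attach-unique S k g h tr gP hP gS hS with h ≟E g
  ... | yes eq = eq
  ... | no ne = ⊥-elim (1+n≰n (≤-trans (commonV-two-edges (S k) (P S k) g h ne
           (λ v en → gS v en , incident-intro (P S k) g v gP en) (λ v en → hS v en , incident-intro (P S k) h v hP en))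
           (≤-reflexive (proj₁ tr))))

  collapse-rigid : ∀ S a t k → Attached S a t → Attached S a k → a t ∉E S k → Collapse S a t k →
    a k ≡ a t × S k ≐ S t
  collapse-rigid S a t k att-t att-k at∉Sk col = ak≡at , Sk≐St
    where
    ak≡at : a k ≡ a t
    ak≡at with ∨-elim {S k (a t)} (trans (sym (col (a t))) (Copy.g∈K hE md (S t) (a t) (copy att-t)))
    ... | inj₁ s = ⊥-elim (true≢false (trans (sym s) at∉Sk))
    ... | inj₂ s = sym (single-true s)
    Sk≐St : S k ≐ S t
    Sk≐St e = trans (cancel-edge (a k) (proj₁ (copy att-k)) (λ _ → refl) e)
      (trans (cong (λ x → minus (copyAt S a k) x e) ak≡at)
        (sym (cancel-edge (a t) (proj₁ (copy att-t)) col e)))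

  collapse-at-f : ∀ S a t → (∀ j → j ≤ t → Attached S a j) → (∀ j → j < t → TreeLike S j) →
    a t ≡ f → ∀ k → k < t → Collapse S a t k → a k ≡ a t × S k ≐ S t
  collapse-at-f S a t att tr at≡f k k<t col =
    collapse-rigid S a t k (att t ≤-refl) (att k (<⇒≤ k<t)) (subst (_∉E S k) (sym at≡f) (f∉tree-like S k (tr k k<t))) col

  collapse-after : ∀ S a t q → (∀ j → j ≤ t → Attached S a j) → (∀ j → j < t → TreeLike S j) →
    q < t → a t ∈E S q → a q ∉E S t → ∀ k → k < t → Collapse S a t k → a k ≡ a t × S k ≐ S t × q < k
  collapse-after S a t q att tr q<t atSq aq∉St k k<t col with S k (a t) in atSk
  ... | true = ⊥-elim (true≢false (trans (sym (subst (_∈E S q) (sym aq≡at) atSq)) (proj₁ (copy (att q (<⇒≤ q<t))))))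
    where
    k≡q : k ≡ q
    k≡q = same-position S t tr k q k<t q<t (a t) atSk atSq
    -- a_q lies in the copy at q = k, hence in the copy at t, but not in S_t
    aq≡at : a q ≡ a t
    aq≡at with ∨-elim {S t (a q)} (trans (col (a q)) (subst (λ k → a q ∈E copyAt S a k) (sym k≡q)
                 (Copy.g∈K hE md (S q) (a q) (copy (att q (<⇒≤ q<t))))))
    ... | inj₁ s = ⊥-elim (true≢false (trans (sym s) aq∉St))
    ... | inj₂ s = single-true s
  ... | false with collapse-rigid S a t k (att t ≤-refl) (att k (<⇒≤ k<t)) atSk col
  ...   | ak≡at , Sk≐St = ak≡at , Sk≐St , q<k
    where
    att-k : Attached S a k
    att-k = att k (<⇒≤ k<t)
    q<k : q < k
    q<k with <-cmp q k
    ... | tri< lt _ _ = lt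
    ... | tri≈ _ refl _ = ⊥-elim (true≢false (trans (sym (subst (_∈E S q) (sym ak≡at) atSq)) (proj₁ (copy att-k))))
    ... | tri> _ _ gt = ⊥-elim (not-in-earlier-copy S a k q (tr q q<t) att-k gt (a t) atSq
                          (subst (_∈E copyAt S a k) ak≡at (Copy.g∈K hE md (S k) (a k) (copy att-k))))

  -- along a root-to-leaf path, position t+1 hangs off position t
  Step : (ℕ → EdgeSet n) → (ℕ → Edge n) → ℕ → Set
  Step S a t = a (suc t) ∈E S t × a t ∉E S (suc t)

  step-no-collapse : ∀ S a t → (∀ j → j ≤ suc t → Attached S a j) → (∀ j → j < suc t → TreeLike S j) →
    Step S a t → NoCollapse S a (suc t)
  step-no-collapse S a t att tr (in-t , not-in) k k<1+t col with collapse-after S a (suc t) t att tr ≤-refl in-t not-in k k<1+t col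
  ... | _ , _ , t<k = <⇒≱ t<k (s≤s⁻¹ k<1+t)

<<⇒≤∸2 : ∀ {a b c} → a < b → b < c → a ≤ c ∸ 2
<<⇒≤∸2 {a} p q = m+n≤o⇒m≤o∸n a (≤-trans (≤-reflexive (+-comm a 2)) (≤-trans (s≤s p) q))

module UnderE3 {m n} (hE : EdgeSet m) (md : MinDeg2 hE) (D : ℕ) (f : Edge n) (Gr : EdgeSet n)
               (e3 : E3 hE D f Gr) where
  open Sequences hE md f Gr

  eH : ℕ
  eH = eSize hE

  extend : (ℕ → EdgeSet n) → ℕ → EdgeSet n → ℕ → EdgeSet n
  extend S d X i with i <? d
  ... | yes _ = S i
  ... | no _ = X

  extend-below : ∀ S d X i → i < d → extend S d X i ≡ S i
  extend-below S d X i i<d with i <? d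
  ... | yes _ = refl
  ... | no i≮d = ⊥-elim (i≮d i<d)

  extend-at : ∀ S d X → extend S d X d ≡ X
  extend-at S d X with d <? d
  ... | yes d<d = ⊥-elim (<-irrefl refl d<d)
  ... | no _ = refl

  P-extend : ∀ S d X j → j ≤ d → P (extend S d X) j ≐ P S j
  P-extend S d X j j≤d = P-cong (extend S d X) S j (λ i i<j e → cong (λ Z → Z e) (extend-below S d X i (<-≤-trans i<j j≤d)))

  no-bad-extension : ∀ S a d X h → 1 ≤ d → suc d ≤ 2 * D →
    (∀ j → j < d → Attached S a j) → (∀ j → j < d → TreeLike S j) →
    h ∈E P S d → InΛ1 hE h X → X ⊆E Gr →
    3 ≤ commonV X (P S d) → commonE X (P S d) ≤ eH ∸ 2 → ⊥
  no-bad-extension S a d X h 1≤d bd att tr hP lamX XGr cv ce =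
    e3 (suc d) S' (s≤s 1≤d , bd , attached , tree-like , last-V , last-E) in-Gr
    where
    S' : ℕ → EdgeSet n
    S' = extend S d X
    below : ∀ j → j < d → S' j ≡ S j
    below = extend-below S d X
    P' : ∀ j → j ≤ d → P S' j ≐ P S j
    P' = P-extend S d X
    attached : ∀ j → j < suc d → ∃ λ g → g ∈E P S' j × InΛ1 hE g (S' j)
    attached j j<1+d with m≤n⇒m<n∨m≡n (s≤s⁻¹ j<1+d)
    ... | inj₁ j<d = a j , trans (P' j (<⇒≤ j<d) (a j)) (attach (att j j<d)) ,
                       subst (InΛ1 hE (a j)) (sym (below j j<d)) (copy (att j j<d))
    ... | inj₂ refl = h , trans (P' j ≤-refl h) hP , subst (InΛ1 hE h) (sym (extend-at S j X)) lamX
    tree-like : ∀ j → suc j < suc d → TreeLike S' j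
    tree-like j 1+j<1+d = trans (commonV-cong Sj (P' j (<⇒≤ j<d))) (proj₁ (tr j j<d)) ,
                          trans (commonE-cong Sj (P' j (<⇒≤ j<d))) (proj₂ (tr j j<d))
      where
      j<d : j < d
      j<d = s≤s⁻¹ 1+j<1+d
      Sj : S' j ≐ S j
      Sj e = cong (λ Z → Z e) (below j j<d)
    Xd : S' d ≐ X
    Xd e = cong (λ Z → Z e) (extend-at S d X)
    last-V : 3 ≤ commonV (S' d) (P S' d)
    last-V = subst (3 ≤_) (sym (commonV-cong Xd (P' d ≤-refl))) cv
    last-E : commonE (S' d) (P S' d) ≤ eH ∸ 2
    last-E = subst (_≤ eH ∸ 2) (sym (commonE-cong Xd (P' d ≤-refl))) ce
    in-Gr : ∀ j → j < suc d → S' j ⊆E Gr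
    in-Gr j j<1+d with m≤n⇒m<n∨m≡n (s≤s⁻¹ j<1+d)
    ... | inj₁ j<d = subst (_⊆E Gr) (sym (below j j<d)) (inGr (att j j<d))
    ... | inj₂ refl = subst (_⊆E Gr) (sym (extend-at S j X)) XGr

  module NonTree (S : ℕ → EdgeSet n) (a : ℕ → Edge n) (t : ℕ) (1≤t : 1 ≤ t)
                 (att : ∀ j → j ≤ t → Attached S a j) (tr : ∀ j → j < t → TreeLike S j)
                 (bd : suc t ≤ 2 * D) (nt : ¬ TreeLike S t) where
    open Copy hE md (S t) (a t) (copy (att t ≤-refl)) public

    att< : ∀ j → j < t → Attached S a j
    att< j j<t = att j (<⇒≤ j<t)

    a-touches-both : ∀ v → Ends (a t) v → BothInc (S t) (P S t) v
    a-touches-both v en = g-touches-G v en , incident-intro (P S t) (a t) v (attach (att t ≤-refl)) en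

    -- S_t meets its prefix in at least three vertices: in an edge (other than
    -- a_t ∉ S_t) and a_t, or else in more than the two endpoints of a_t
    three-common : 3 ≤ commonV (S t) (P S t)
    three-common with empty-or-edge (S t ∩E P S t)
    ... | inj₂ (e , h) with ∧-elim {S t e} h
    ...   | eS , eP = commonV-two-edges (S t) (P S t) (a t) e e≢a
                        (a-touches-both)
                        (λ v en → incident-intro (S t) e v eS en , incident-intro (P S t) e v eP en)
      where
      e≢a : ¬ (e ≡ a t)
      e≢a refl = true≢false (trans (sym eS) (proj₁ (copy (att t ≤-refl))))
    three-common | inj₁ none = ≤∧≢⇒< (commonV-edge (S t) (P S t) (a t) a-touches-both)
                                 (λ two → nt (sym two , trans (eSize-cong (λ e → none e)) (eSize-∅ {n})))

    -- since S_t has fewer than e_H edges, E₃ forces all of S_t into the prefix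
    S⊆P : S t ⊆E P S t
    S⊆P with empty-or-edge (λ e → S t e ∧ not (P S t e))
    ... | inj₁ none = λ e eS → ∧-not-false eS (none e)
    ... | inj₂ (e , h) = ⊥-elim (no-bad-extension S a t (S t) (a t) 1≤t bd att< tr
                            (attach (att t ≤-refl)) (copy (att t ≤-refl)) (inGr (att t ≤-refl))
                            three-common few-common)
      where
      eS : e ∈E S t
      eS = proj₁ (∧-elim {S t e} h)
      eP : e ∉E P S t
      eP = not-true (proj₂ (∧-elim {S t e} h))
      few-common : commonE (S t) (P S t) ≤ eH ∸ 2
      few-common = <<⇒≤∸2 (eSize-strict (λ e' h' → proj₁ (∧-elim {S t e'} h')) e eS
                             (trans (cong (S t e ∧_) eP) (∧-zeroʳ (S t e)))) eSize-G

    K⊆P : K ⊆E P S t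
    K⊆P e ke with ∨-elim {S t e} ke
    ... | inj₁ se = S⊆P e se
    ... | inj₂ s = subst (_∈E P S t) (sym (single-true s)) (attach (att t ≤-refl))

    -- some earlier graph S_k meets K: otherwise K ⊆ {f}, yet K has two edges at lo(a_t)
    last-meeting : Σ ℕ λ k → k < t × Meet K (S k) × (∀ i → k < i → i < t → ¬ Meet K (S i))
    last-meeting with largest-below (λ k → Meet K (S k)) (λ k → meet? K (S k)) t
    ... | inj₁ found = found
    ... | inj₂ none with Iso.other-edge hE K iso md (a t) (lo (a t)) g∈K (inj₁ refl)
    ...   | e₂ , ke₂ , e₂≢a , _ = ⊥-elim (e₂≢a (trans (only-f e₂ ke₂) (sym (only-f (a t) g∈K))))
      where
      only-f : ∀ e → e ∈E K → e ≡ f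
      only-f e ke with P-elim S t e (K⊆P e ke)
      ... | inj₁ eq = eq
      ... | inj₂ (i , i<t , se) = ⊥-elim (none i i<t (e , ke , se))

    -- At the last position k < t whose graph meets K, K consists of S_k and a
    -- single prefix edge h.
    module AtLast (k : ℕ) (k<t : k < t) (e₁ : Edge n) (e₁K : e₁ ∈E K) (e₁S : e₁ ∈E S k)
                  (after : ∀ i → k < i → i < t → ¬ Meet K (S i)) where
      att-k : Attached S a k
      att-k = att k (<⇒≤ k<t)

      K⊆Pk∪Sk : ∀ e → e ∈E K → e ∈E P S k ⊎ e ∈E S k
      K⊆Pk∪Sk e ke with P-elim S t e (K⊆P e ke)
      ... | inj₁ refl = inj₁ (P-f S k)
      ... | inj₂ (i , i<t , se) with <-cmp i k
      ...   | tri< i<k _ _ = inj₁ (P-intro S k i e i<k se)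
      ...   | tri≈ _ refl _ = inj₂ se
      ...   | tri> _ _ k<i = ⊥-elim (after i k<i i<t (e , ke , se))

      -- K has more edges than S_k, so some edge of K lies in P S k
      prefix-edge : ∃ λ e → e ∈E K × e ∈E P S k
      prefix-edge with empty-or-edge (λ e → K e ∧ not (S k e))
      ... | inj₂ (e , h) with ∧-elim {K e} h
      ...   | ke , nse = e , ke , [ (λ p → p) , (λ se → ⊥-elim (true≢false (trans (sym se) (not-true nse)))) ]′ (K⊆Pk∪Sk e ke)
      prefix-edge | inj₁ none = ⊥-elim (<-irrefl refl (≤-<-trans (≤-trans (≤-reflexive (sym eSize-K)) (eSize-mono K⊆Sk))
                                   (Copy.eSize-G hE md (S k) (a k) (copy att-k))))
        where
        K⊆Sk : K ⊆E S k
        K⊆Sk e ke = ∧-not-false ke (none e)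

      -- the edge h removed from K: f if f ∈ K, otherwise any edge of K in P S k
      removed : Σ (Edge n) λ h → h ∈E K × h ∈E P S k × (f ∈E K → h ≡ f)
      removed with K f in kf
      ... | true = f , kf , P-f S k , λ _ → refl
      ... | false with prefix-edge
      ...   | e , ke , pe = e , ke , pe , λ fK → ⊥-elim (true≢false (sym fK))

      h : Edge n
      h = proj₁ removed
      h∈K : h ∈E K
      h∈K = proj₁ (proj₂ removed)
      h∈P : h ∈E P S k
      h∈P = proj₁ (proj₂ (proj₂ removed))
      h≡f : f ∈E K → h ≡ f
      h≡f = proj₂ (proj₂ (proj₂ removed))

      X : EdgeSet n
      X = minus K h

      X-copy : InΛ1 hE h X
      X-copy = minus-∉ K h , iso-cong hE (minus-∪-single K h h∈K) iso

      -- X lies in 𝔾: its edges are in S_t or equal a_t ≠ h, and a_t ≠ f lies in an earlier graph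
      at∈Gr : ¬ (a t ≡ f) → a t ∈E Gr
      at∈Gr a≢f with P-elim S t (a t) (attach (att t ≤-refl))
      ... | inj₁ a≡f = ⊥-elim (a≢f a≡f)
      ... | inj₂ (i , i<t , si) = inGr (att< i i<t) (a t) si

      X⊆Gr : X ⊆E Gr
      X⊆Gr e xe with ∨-elim {S t e} (minus-⊆ K h e xe)
      ... | inj₁ se = inGr (att t ≤-refl) e se
      ... | inj₂ s = let e≡a = single-true s in
        subst (_∈E Gr) (sym e≡a)
          (at∈Gr (λ a≡f → minus-≢ K {h} {e} xe (trans e≡a (trans a≡f (sym (h≡f (subst (_∈E K) a≡f g∈K)))))))

      -- X contains an edge of S_k, which misses P S k, and has fewer than e_H edges
      few-common : commonE X (P S k) ≤ eH ∸ 2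
      few-common = <<⇒≤∸2 (eSize-strict (λ e h' → proj₁ (∧-elim {X e} h')) e₁ e₁X
                             (trans (cong (X e₁ ∧_) e₁∉P) (∧-zeroʳ (X e₁))))
                           (subst (eSize X <_) eSize-K (eSize-strict (minus-⊆ K h) h h∈K (minus-∉ K h)))
        where
        e₁∉P : e₁ ∉E P S k
        e₁∉P = false-if (tree-like-disjoint S k (tr k k<t) e₁ e₁S)
        e₁X : e₁ ∈E X
        e₁X = minus-∈ K e₁K (λ e₁≡h → true≢false (trans (sym h∈P) (subst (_∉E P S k) e₁≡h e₁∉P)))

      -- by E₃, h is the only edge of K in P S k
      only-h : ∀ h' → h' ∈E K → h' ∈E P S k → h' ≡ h
      only-h h' h'K h'P with h' ≟E h
      ... | yes eq = eq
      ... | no ne = ⊥-elim (no-bad-extension S a k X h 1≤k (≤-trans k<t (≤-trans (n≤1+n t) bd))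
                      (λ j j<k → att j (<⇒≤ (<-trans j<k k<t))) (λ j j<k → tr j (<-trans j<k k<t))
                      h∈P X-copy X⊆Gr three few-common)
        where
        -- the prefix at 0 is {f}, which has no two distinct edges
        1≤k : 1 ≤ k
        1≤k = n≢0⇒n>0 λ { refl → ne (trans (P₀-elim S h' h'P) (sym (P₀-elim S h h∈P))) }
        three : 3 ≤ commonV X (P S k)
        three = commonV-two-edges X (P S k) h h' ne
                  (λ v en → Iso.minus-incident hE K iso md h v h∈K en , incident-intro (P S k) h v h∈P en)
                  (λ v en → incident-intro X h' v (minus-∈ K h'K ne) en , incident-intro (P S k) h' v h'P en)

      h∉Sk : h ∉E S k
      h∉Sk = false-if (λ sh → tree-like-disjoint S k (tr k k<t) h sh h∈P)

      -- so K ⊆ S_k ∪ {h}, and both have e_H edges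
      K≐Sk+h : K ≐ (S k ∪E single h)
      K≐Sk+h = ⊆-eSize-≐ K⊆ (≤-trans (eSize-∪-single (S k) h) (≤-trans (Copy.eSize-G hE md (S k) (a k) (copy att-k)) (≤-reflexive (sym eSize-K))))
        where
        K⊆ : K ⊆E (S k ∪E single h)
        K⊆ e ke with K⊆Pk∪Sk e ke
        ... | inj₁ pe = ∨-introʳ (S k e) (subst (λ z → single h z ≡ true) (sym (only-h e ke pe)) (single-refl h))
        ... | inj₂ se = ∨-introˡ (single h e) se

  tree-or-collapse : ∀ S a t → (∀ j → j ≤ t → Attached S a j) → (∀ j → j < t → TreeLike S j) → suc t ≤ 2 * D →
    TreeLike S t ⊎ (∃ λ k → k < t × Collapse S a t k)
  tree-or-collapse S a zero att tr bd = inj₁ (tree-like-0 S a (att 0 z≤n))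
  tree-or-collapse S a t@(suc _) att tr bd with tree-like? S t
  ... | yes tl = inj₁ tl
  ... | no nt with NonTree.last-meeting S a t (s≤s z≤n) att tr bd nt
  ...   | k , k<t , (e₁ , e₁K , e₁S) , after = inj₂ (k , k<t , collapse)
    where
    open NonTree S a t (s≤s z≤n) att tr bd nt
    open AtLast k k<t e₁ e₁K e₁S after
    -- h is the attachment a_k: both lie in P S k and touch S_k, which is tree-like
    h≡ak : h ≡ a k
    h≡ak = attach-unique S k (a k) h (tr k k<t) (attach att-k) h∈P
             (Copy.g-touches-G hE md (S k) (a k) (copy att-k))
             (Copy.g-touches-G hE md (S k) h (h∉Sk , iso-cong hE K≐Sk+h iso))
    collapse : Collapse S a t k
    collapse e = trans (K≐Sk+h e) (cong (λ x → (S k ∪E single x) e) h≡ak)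

  all-tree-like : ∀ S a L → L ≤ 2 * D → (∀ j → j < L → Attached S a j) →
    (∀ t → t < L → (∀ j → j < t → TreeLike S j) → NoCollapse S a t) → ∀ j → j < L → TreeLike S j
  all-tree-like S a L bd att nc = go L ≤-refl
    where
    go : ∀ t → t ≤ L → ∀ j → j < t → TreeLike S j
    go (suc t) 1+t≤L j j<1+t with m≤n⇒m<n∨m≡n (s≤s⁻¹ j<1+t)
    ... | inj₁ j<t = go t (<⇒≤ 1+t≤L) j j<t
    ... | inj₂ refl with tree-or-collapse S a j (λ i i≤j → att i (≤-<-trans i≤j 1+t≤L)) (go j (<⇒≤ 1+t≤L)) (≤-trans 1+t≤L bd)
    ...   | inj₁ tl = tl
    ...   | inj₂ (k , k<j , col) = ⊥-elim (nc j 1+t≤L (go j (<⇒≤ 1+t≤L)) k k<j col)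

-- A root-to-node path (G₁,…,G_j; g₀,…,g_{j-1})
-- of the tree, read as the sequence S_i = G_{i+1}, a_i = g_i, is attached and
-- hangs off itself step by step; so it never collapses and all its positions
-- are tree-like.  (P1) and (P2) follow from the resulting disjointness, (P3)
-- from the fact that an excluded child collapses onto its parent's copy.
module Tree {m n} (hE : EdgeSet m) (md : MinDeg2 hE) (D : ℕ) (f : Edge n) (Gr : EdgeSet n)
            (e3 : E3 hE D f Gr) where
  open Sequences hE md f Gr
  open UnderE3 hE md D f Gr e3

  module PathFacts {j G g} (pu : PathU hE Gr f j G g) where
    root : g 0 ≡ f
    root = proj₁ pu

    label : ∀ i → i < j → InΛ hE Gr (g i) (G (suc i))
    label i i<j = proj₁ (proj₁ (proj₂ pu) (suc i) (s≤s z≤n) i<j)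

    grandparent : ∀ i → suc (suc i) ≤ j → g i ∉E G (suc (suc i))
    grandparent i le = proj₂ (proj₁ (proj₂ pu) (suc (suc i)) (s≤s z≤n) le) (s≤s (s≤s z≤n))

    next : ∀ i → suc i < j → g (suc i) ∈E G (suc i)
    next i lt = proj₂ (proj₂ pu) (suc i) (s≤s z≤n) lt

  module Concat (j : ℕ) (G : ℕ → EdgeSet n) (g : ℕ → Edge n) (T : ℕ → EdgeSet n) (b : ℕ → Edge n) where
    S : ℕ → EdgeSet n
    S i with i <? j
    ... | yes _ = G (suc i)
    ... | no _ = T (i ∸ j)

    a : ℕ → Edge n
    a i with i <? j
    ... | yes _ = g i
    ... | no _ = b (i ∸ j)

    S-lo : ∀ i → i < j → S i ≡ G (suc i)
    S-lo i i<j with i <? j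
    ... | yes _ = refl
    ... | no i≮j = ⊥-elim (i≮j i<j)

    a-lo : ∀ i → i < j → a i ≡ g i
    a-lo i i<j with i <? j
    ... | yes _ = refl
    ... | no i≮j = ⊥-elim (i≮j i<j)

    S-hi : ∀ r → S (r + j) ≡ T r
    S-hi r with (r + j) <? j
    ... | yes lt = ⊥-elim (<⇒≱ lt (m≤n+m j r))
    ... | no _ = cong T (m+n∸n≡m r j)

    a-hi : ∀ r → a (r + j) ≡ b r
    a-hi r with (r + j) <? j
    ... | yes lt = ⊥-elim (<⇒≱ lt (m≤n+m j r))
    ... | no _ = cong b (m+n∸n≡m r j)

    ∈S-lo : ∀ i e → i < j → e ∈E G (suc i) → e ∈E S i
    ∈S-lo i e i<j h = subst (e ∈E_) (sym (S-lo i i<j)) h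

    module OnPath (pu : PathU hE Gr f j G g) where
      open PathFacts pu

      attached : ∀ i → i < j → Attached S a i
      attached i i<j = record
        { attach = subst (_∈E P S i) (sym (a-lo i i<j)) (attach-path i i<j)
        ; copy = subst₂ (InΛ1 hE) (sym (a-lo i i<j)) (sym (S-lo i i<j)) (proj₂ (label i i<j))
        ; inGr = subst (_⊆E Gr) (sym (S-lo i i<j)) (proj₁ (label i i<j)) }
        where
        attach-path : ∀ i → i < j → g i ∈E P S i
        attach-path zero _ = subst (_∈E P S 0) (sym root) (P-f S 0)
        attach-path (suc i) lt = P-intro S (suc i) i (g (suc i)) ≤-refl (∈S-lo i (g (suc i)) (<-trans ≤-refl lt) (next i lt))

      step : ∀ t → suc t < j → Step S a t
      step t lt = subst (_∈E S t) (sym (a-lo (suc t) lt)) (∈S-lo t (g (suc t)) (<-trans ≤-refl lt) (next t lt)) ,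
                  subst₂ _∉E_ (sym (a-lo t (<-trans ≤-refl lt))) (sym (S-lo (suc t) lt)) (grandparent t lt)

      no-collapse : ∀ t → t < j → (∀ i → i < t → TreeLike S i) → NoCollapse S a t
      no-collapse zero _ _ k ()
      no-collapse (suc t) lt tr =
        step-no-collapse S a t (λ i i≤1+t → attached i (≤-<-trans i≤1+t lt)) tr (step t lt)

      tree-like : j ≤ 2 * D → ∀ i → i < j → TreeLike S i
      tree-like bd = all-tree-like S a j bd attached no-collapse

  path-disjoint : ∀ j G g → PathU hE Gr f j G g → j ≤ 2 * D →
    ∀ i → 1 ≤ i → i < j → ∀ e → e ∈E G i → e ∈E G j → ⊥
  path-disjoint (suc j) G g pu bd (suc i) _ i<j e ei ej =
    tree-like-disjoint S j (tree-like bd j ≤-refl) e (∈S-lo j e ≤-refl ej)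
      (P-intro S j i e (s≤s⁻¹ i<j) (∈S-lo i e (<-trans (s≤s⁻¹ i<j) ≤-refl) ei))
    where
    open Concat (suc j) G g (λ _ → ∅E) (λ _ → f)
    open OnPath pu

  D≤2D : D ≤ 2 * D
  D≤2D = m≤m+n D (D + 0)

  P1 : ∀ j G g → 1 ≤ j → j ≤ D → PathU hE Gr f j G g → f ∉E G j
  P1 (suc j) G g _ jD pu = subst (f ∉E_) (S-lo j ≤-refl) (f∉tree-like S j (tree-like (≤-trans jD D≤2D) j ≤-refl))
    where
    open Concat (suc j) G g (λ _ → ∅E) (λ _ → f)
    open OnPath pu

  -- (P3) with constant 1: a child G₀ of the node g_j excluded because it
  -- contains g_{j-1} forms the same copy as its parent, so G₀ = (G_j ∪ {g_{j-1}}) - g_j.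
  module ExcludedChild (j : ℕ) (G : ℕ → EdgeSet n) (g : ℕ → Edge n) (jD : suc j < D)
                       (pu : PathU hE Gr f (suc j) G g) (g∈G : 1 ≤ suc j → g (suc j) ∈E G (suc j))
                       (G₀ : EdgeSet n) (G₀Λ : InΛ hE Gr (g (suc j)) G₀) (gj∈G₀ : g j ∈E G₀) where
    open Concat (suc j) G g (λ _ → G₀) (λ _ → g (suc j))
    open OnPath pu

    attached-child : ∀ i → i ≤ suc j → Attached S a i
    attached-child i i≤ with m≤n⇒m<n∨m≡n i≤
    ... | inj₁ i<j = attached i i<j
    ... | inj₂ refl = record
      { attach = subst (_∈E P S (suc j)) (sym (a-hi 0)) (P-intro S (suc j) j (g (suc j)) ≤-refl gj+1∈S)
      ; copy = subst₂ (InΛ1 hE) (sym (a-hi 0)) (sym (S-hi 0)) (proj₂ G₀Λ)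
      ; inGr = subst (_⊆E Gr) (sym (S-hi 0)) (proj₁ G₀Λ) }
      where
      gj+1∈S : g (suc j) ∈E S j
      gj+1∈S = ∈S-lo j _ ≤-refl (g∈G (s≤s z≤n))

    trees : ∀ i → i < suc j → TreeLike S i
    trees = tree-like (≤-trans (<⇒≤ jD) D≤2D)

    -- the child is not tree-like: it contains g_j, which lies in its prefix
    not-tree-like : ¬ TreeLike S (suc j)
    not-tree-like tl = tree-like-disjoint S (suc j) tl (g j) (subst (g j ∈E_) (sym (S-hi 0)) gj∈G₀)
      (P-mono S j (suc j) (n≤1+n j) (g j) (subst (_∈E P S j) (a-lo j ≤-refl) (attach (attached j ≤-refl))))

    -- so it collapses, necessarily onto its parent: g_{j+1} ∈ S_j lies in no earlier copy
    collapses-on-parent : ∀ k → k < suc j → Collapse S a (suc j) k → k ≡ j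
    collapses-on-parent k k<1+j col with m≤n⇒m<n∨m≡n (s≤s⁻¹ k<1+j)
    ... | inj₂ k≡j = k≡j
    ... | inj₁ k<j = ⊥-elim (not-in-earlier-copy S a k j (trees j ≤-refl) (attached k (<-trans k<j ≤-refl)) k<j
                       (a (suc j)) (subst (_∈E S j) (sym (a-hi 0)) (∈S-lo j _ ≤-refl (g∈G (s≤s z≤n))))
                       (trans (sym (col (a (suc j)))) (Copy.g∈K hE md (S (suc j)) (a (suc j)) (copy (attached-child (suc j) ≤-refl)))))

    determined : G₀ ≐ minus (G (suc j) ∪E single (g j)) (g (suc j))
    determined with tree-or-collapse S a (suc j) attached-child trees (≤-trans jD D≤2D)
    ... | inj₁ tl = ⊥-elim (not-tree-like tl)
    ... | inj₂ (k , k<1+j , col) with collapses-on-parent k k<1+j col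
    ...   | refl = cancel-edge (g (suc j)) (proj₁ (proj₂ G₀Λ)) same
      where
      same : (G₀ ∪E single (g (suc j))) ≐ (G (suc j) ∪E single (g j))
      same e = trans (cong₂ (λ Z z → (Z ∪E single z) e) (sym (S-hi 0)) (sym (a-hi 0)))
                 (trans (col e) (cong₂ (λ Z z → (Z ∪E single z) e) (S-lo j ≤-refl) (a-lo j ≤-refl)))

  -- (P3): the root has no excluded children, and below it all excluded children coincide
  P3 : ∀ j G g → j < D → PathV hE Gr f j G g →
     (∃ λ G₀ → InΛ hE Gr (g j) G₀ × ChildOK j g G₀) →
     AtMost 1 (λ G₀ → InΛ hE Gr (g j) G₀ × Excluded j g G₀)
  P3 zero G g _ _ _ [] _ _ = z≤n
  P3 zero G g _ _ _ (_ ∷ _) (() ∷ _) _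
  P3 (suc j) G g jD (pu , g∈G) _ [] _ _ = z≤n
  P3 (suc j) G g jD (pu , g∈G) _ (_ ∷ []) _ _ = s≤s z≤n
  P3 (suc j) G g jD (pu , g∈G) _ (G₀ ∷ G₁ ∷ _) ((Λ₀ , ex₀) ∷ (Λ₁ , ex₁) ∷ _) ((G₀≠G₁ ∷ _) ∷ _) =
    ⊥-elim (G₀≠G₁ λ e → trans (determined G₀ Λ₀ ex₀ e) (sym (determined G₁ Λ₁ ex₁ e)))
    where
    determined : ∀ G₀ → InΛ hE Gr (g (suc j)) G₀ → g j ∈E G₀ → G₀ ≐ minus (G (suc j) ∪E single (g j)) (g (suc j))
    determined = ExcludedChild.determined j G g jD pu g∈G

  module TwoPaths (j : ℕ) (G : ℕ → EdgeSet n) (g : ℕ → Edge n) (j' : ℕ) (G' : ℕ → EdgeSet n) (g' : ℕ → Edge n) where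
    AgreeAt : ℕ → Set
    AgreeAt i = G (suc i) ≐ G' (suc i) × g i ≡ g' i

    agreeAt? : ∀ i → Dec (AgreeAt i)
    agreeAt? i = ≐-dec (G (suc i)) (G' (suc i)) ×-dec (g i ≟E g' i)

    Agree : ℕ → Set
    Agree c = ∀ i → i < c → AgreeAt i

    divergence : ∀ b → Σ ℕ λ c → c ≤ b × Agree c × (c ≡ b ⊎ ¬ AgreeAt c)
    divergence zero = 0 , z≤n , (λ _ ()) , inj₁ refl
    divergence (suc b) with divergence b
    ... | c , c≤b , ag , inj₂ differ = c , m≤n⇒m≤1+n c≤b , ag , inj₂ differ
    ... | c , _ , ag , inj₁ refl with agreeAt? c
    ...   | no differ = c , n≤1+n c , ag , inj₂ differ
    ...   | yes same = suc c , ≤-refl , agree-more , inj₁ refl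
      where
      agree-more : Agree (suc c)
      agree-more i i<1+c with m≤n⇒m<n∨m≡n (s≤s⁻¹ i<1+c)
      ... | inj₁ i<c = ag i i<c
      ... | inj₂ refl = same

    leaving-edge : PathU hE Gr f j' G' g' → ∀ c → Agree c → c < j' →
      (c ≡ 0 × g' c ≡ f) ⊎ (Σ ℕ λ c₁ → c ≡ suc c₁ × g' c ∈E G (suc c₁))
    leaving-edge pu' zero _ _ = inj₁ (refl , PathFacts.root pu')
    leaving-edge pu' (suc c₁) agree c<j' =
      inj₂ (c₁ , refl , trans (proj₁ (agree c₁ ≤-refl) (g' (suc c₁))) (PathFacts.next pu' c₁ c<j'))

    -- If the paths agree for c steps and then differ, with c < j and
    -- j' = r₀ + c + 1, then splicing the rest of the second path onto the first
    -- gives an attached sequence without collapses.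
    module Splice (pu : PathU hE Gr f j G g) (pu' : PathU hE Gr f j' G' g')
                  (c : ℕ) (agree : Agree c) (differ : ¬ AgreeAt c) (c<j : c < j)
                  (r₀ : ℕ) (j'≡ : j' ≡ suc (r₀ + c)) (jD : j ≤ D) (j'D : j' ≤ D) where
      open Concat j G g (λ r → G' (suc (r + c))) (λ r → g' (r + c))
      open OnPath pu
      module P = PathFacts pu
      module P' = PathFacts pu'

      L : ℕ
      L = suc r₀ + j

      L≤2D : L ≤ 2 * D
      L≤2D = ≤-trans (≤-reflexive (+-comm (suc r₀) j))
               (+-mono-≤ jD (≤-trans (≤-trans (s≤s (m≤m+n r₀ c)) (≤-reflexive (sym j'≡))) (≤-trans j'D (m≤m+n D 0))))

      r+c<j' : ∀ r → r ≤ r₀ → r + c < j'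
      r+c<j' r r≤r₀ = subst (r + c <_) (sym j'≡) (s≤s (+-monoˡ-≤ c r≤r₀))

      leaving : (c ≡ 0 × g' c ≡ f) ⊎ (Σ ℕ λ c₁ → c ≡ suc c₁ × g' c ∈E G (suc c₁))
      leaving = leaving-edge pu' c agree (r+c<j' 0 z≤n)

      -- g'_c is f or lies in G_c = S_{c-1}
      c₁<j : ∀ {c₁} → c ≡ suc c₁ → c₁ < j
      c₁<j {c₁} c≡ = <-trans (n<1+n c₁) (subst (_< j) c≡ c<j)

      junction-attach : g' c ∈E P S j
      junction-attach with leaving
      ... | inj₁ (_ , g'c≡f) = subst (_∈E P S j) (sym g'c≡f) (P-f S j)
      ... | inj₂ (c₁ , c≡ , inG) = P-intro S j c₁ (g' c) (c₁<j c≡) (∈S-lo c₁ _ (c₁<j c≡) inG)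

      attached-hi : ∀ r → r ≤ r₀ → Attached S a (r + j)
      attached-hi r r≤r₀ = record
        { attach = subst (_∈E P S (r + j)) (sym (a-hi r)) (attach-hi r r≤r₀)
        ; copy = subst₂ (InΛ1 hE) (sym (a-hi r)) (sym (S-hi r)) (proj₂ (P'.label (r + c) (r+c<j' r r≤r₀)))
        ; inGr = subst (_⊆E Gr) (sym (S-hi r)) (proj₁ (P'.label (r + c) (r+c<j' r r≤r₀))) }
        where
        attach-hi : ∀ r → r ≤ r₀ → g' (r + c) ∈E P S (r + j)
        attach-hi zero _ = junction-attach
        attach-hi (suc r) le = P-intro S (suc r + j) (r + j) _ ≤-refl
          (subst (g' (suc r + c) ∈E_) (sym (S-hi r)) (P'.next (r + c) (r+c<j' (suc r) le)))

      split-position : ∀ t → t < L → t < j ⊎ Σ ℕ λ r → r ≤ r₀ × t ≡ r + j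
      split-position t t<L with t <? j
      ... | yes t<j = inj₁ t<j
      ... | no t≮j = inj₂ (t ∸ j , s≤s⁻¹ (+-cancelʳ-< j (t ∸ j) (suc r₀) (subst (_< L) (sym t≡) t<L)) , sym t≡)
        where
        t≡ : t ∸ j + j ≡ t
        t≡ = m∸n+n≡m (≮⇒≥ t≮j)

      attached-spliced : ∀ t → t < L → Attached S a t
      attached-spliced t t<L with split-position t t<L
      ... | inj₁ t<j = attached t t<j
      ... | inj₂ (r , r≤r₀ , refl) = attached-hi r r≤r₀

      step-hi : ∀ r → suc r ≤ r₀ → Step S a (r + j)
      step-hi r le = subst₂ _∈E_ (sym (a-hi (suc r))) (sym (S-hi r)) (P'.next (r + c) (r+c<j' (suc r) le)) ,
                     subst₂ _∉E_ (sym (a-hi r)) (sym (S-hi (suc r))) (P'.grandparent (r + c) (r+c<j' (suc r) le))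

      att≤j : ∀ i → i ≤ j → Attached S a i
      att≤j i i≤j = attached-spliced i (s≤s (≤-trans i≤j (m≤n+m j r₀)))

      agree-from-collapse : ∀ k → k < j → k ≡ c → a k ≡ a j → S k ≐ S j → AgreeAt c
      agree-from-collapse k k<j refl ak≡aj Sk≐Sj =
        (λ e → trans (sym (cong (λ Z → Z e) (S-lo k k<j))) (trans (Sk≐Sj e) (cong (λ Z → Z e) (S-hi 0)))) ,
        trans (sym (a-lo k k<j)) (trans ak≡aj (a-hi 0))

      -- if the second path leaves the first at an edge of G_c = S_{c-1}, the
      -- copy at j can only collapse onto the copy at c, and then AgreeAt c
      junction-inside : ∀ c₁ → c ≡ suc c₁ → g' c ∈E G (suc c₁) →
        (∀ i → i < j → TreeLike S i) → NoCollapse S a j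
      junction-inside c₁ c≡ inG tr k k<j col with collapse-after S a j c₁ att≤j tr (c₁<j c≡) aj∈Sc₁ ac₁∉Sj k k<j col
        where
        aj∈Sc₁ : a j ∈E S c₁
        aj∈Sc₁ = subst (_∈E S c₁) (sym (a-hi 0)) (∈S-lo c₁ _ (c₁<j c≡) inG)
        c₁<c : c₁ < c
        c₁<c = subst (c₁ <_) (sym c≡) ≤-refl
        ac₁∉Sj : a c₁ ∉E S j
        ac₁∉Sj = subst₂ _∉E_ (sym (trans (a-lo c₁ (c₁<j c≡)) (proj₂ (agree c₁ c₁<c)))) (sym (trans (S-hi 0) (cong (λ i → G' (suc i)) c≡)))
                   (P'.grandparent c₁ (subst (_< j') c≡ (r+c<j' 0 z≤n)))
      ... | ak≡aj , Sk≐Sj , c₁<k with k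
      ...   | suc k₁ = differ (agree-from-collapse (suc k₁) k<j (trans (cong suc k₁≡c₁) (sym c≡)) ak≡aj Sk≐Sj)
        where
        k₁≡c₁ : k₁ ≡ c₁
        k₁≡c₁ = same-position S j tr k₁ c₁ (<-trans ≤-refl k<j) (c₁<j c≡) (a j)
                  (subst (_∈E S k₁) (trans (sym (a-lo (suc k₁) k<j)) ak≡aj) (∈S-lo k₁ _ (<-trans ≤-refl k<j) (P.next k₁ k<j)))
                  (subst (_∈E S c₁) (sym (a-hi 0)) (∈S-lo c₁ _ (c₁<j c≡) inG))

      junction : (∀ i → i < j → TreeLike S i) → NoCollapse S a j
      junction tr k k<j col with leaving
      ... | inj₁ (c≡0 , g'c≡f) with collapse-at-f S a j att≤j tr (trans (a-hi 0) g'c≡f) k k<j col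
      ...   | ak≡aj , Sk≐Sj with k
      ...     | zero = differ (agree-from-collapse 0 k<j (sym c≡0) ak≡aj Sk≐Sj)
      ...     | suc k₁ = true≢false (trans (sym f∈Sk₁) (f∉tree-like S k₁ (tr k₁ (<-trans ≤-refl k<j))))
        where
        -- a_k = g_k ∈ G_k = S_{k-1} would be f
        f∈Sk₁ : f ∈E S k₁
        f∈Sk₁ = subst (_∈E S k₁) (trans (sym (a-lo (suc k₁) k<j)) (trans ak≡aj (trans (a-hi 0) g'c≡f)))
                  (∈S-lo k₁ _ (<-trans ≤-refl k<j) (P.next k₁ k<j))
      junction tr k k<j col | inj₂ (c₁ , c≡ , inG) = junction-inside c₁ c≡ inG tr k k<j col

      no-collapse-spliced : ∀ t → t < L → (∀ i → i < t → TreeLike S i) → NoCollapse S a t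
      no-collapse-spliced t t<L with split-position t t<L
      ... | inj₁ t<j = no-collapse t t<j
      ... | inj₂ (zero , _ , refl) = junction
      ... | inj₂ (suc r , r<r₀ , refl) = λ tr → step-no-collapse S a (r + j)
              (λ i i≤ → attached-spliced i (s≤s (≤-trans i≤ (+-monoˡ-≤ j r<r₀)))) tr (step-hi r r<r₀)

      -- hence G_j = S_{j-1} and G'_{j'} = S_{r₀+j} are edge-disjoint
      disjoint : ∀ e → e ∈E G j → e ∈E G' j' → ⊥
      disjoint e ej ej' = tree-like-disjoint S (r₀ + j) (trees (r₀ + j) ≤-refl) e
          (subst (e ∈E_) (sym (S-hi r₀)) (subst (λ i → e ∈E G' i) j'≡ ej'))
          (P-intro S (r₀ + j) j₁ e (<-≤-trans j₁<j (m≤n+m j r₀)) (∈S-lo j₁ e j₁<j (subst (λ i → e ∈E G i) (sym 1+j₁≡j) ej)))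
        where
        trees : ∀ i → i < L → TreeLike S i
        trees = all-tree-like S a L L≤2D attached-spliced no-collapse-spliced
        j₁ : ℕ
        j₁ = j ∸ 1
        1+j₁≡j : suc j₁ ≡ j
        1+j₁≡j = m+[n∸m]≡n (≤-trans (s≤s z≤n) c<j)
        j₁<j : j₁ < j
        j₁<j = subst (j₁ <_) 1+j₁≡j ≤-refl

    agree-labels : ∀ c → Agree c → ∀ i → 1 ≤ i → i ≤ c → G i ≐ G' i
    agree-labels c agree (suc i) _ i<c = proj₁ (agree i i<c)

  P2 : ∀ j G g j' G' g' → 1 ≤ j → j ≤ D → 1 ≤ j' → j' ≤ D →
     PathU hE Gr f j G g → PathU hE Gr f j' G' g' → ¬ SameU j G g j' G' g' →
     ∀ e → e ∈E G j → e ∈E G' j' → ⊥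
  P2 j G g j' G' g' 1≤j jD 1≤j' j'D pu pu' notSame e ej ej'
    with TwoPaths.divergence j G g j' G' g' (j ⊓ j')
  ... | c , c≤ , agree , stop with c ≟ℕ j | c ≟ℕ j'
  ...   | yes refl | yes refl =
          notSame (refl , TwoPaths.agree-labels j G g j' G' g' c agree , λ i i<c → proj₂ (agree i i<c))
  ...   | yes refl | no c≢j' =
          path-disjoint j' G' g' pu' (≤-trans j'D D≤2D) c 1≤j (≤∧≢⇒< (≤-trans c≤ (m⊓n≤n c j')) c≢j') e
            (trans (sym (TwoPaths.agree-labels j G g j' G' g' c agree c 1≤j ≤-refl e)) ej) ej'
  ...   | no c≢j | yes refl =
          path-disjoint j G g pu (≤-trans jD D≤2D) c 1≤j' (≤∧≢⇒< (≤-trans c≤ (m⊓n≤m j c)) c≢j) e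
            (trans (TwoPaths.agree-labels j G g j' G' g' c agree c 1≤j' ≤-refl e) ej') ej
  ...   | no c≢j | no c≢j' =
          TwoPaths.Splice.disjoint j G g j' G' g' pu pu' c agree differ c<j (j' ∸ suc c) j'≡ jD j'D e ej ej'
    where
    c<j : c < j
    c<j = ≤∧≢⇒< (≤-trans c≤ (m⊓n≤m j j')) c≢j
    c<j' : c < j'
    c<j' = ≤∧≢⇒< (≤-trans c≤ (m⊓n≤n j j')) c≢j'
    j'≡ : j' ≡ suc ((j' ∸ suc c) + c)
    j'≡ = trans (sym (m∸n+n≡m c<j')) (+-suc (j' ∸ suc c) c)
    -- c is not j ⊓ j', so the paths differ at step c
    differ : ¬ TwoPaths.AgreeAt j G g j' G' g' c
    differ = [ (λ c≡ → ⊥-elim ([ (λ m → c≢j (trans c≡ m)) , (λ m → c≢j' (trans c≡ m)) ]′ (⊓-sel j j'))) , (λ d → d) ]′ stop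

-- The theorem, with C = 1: H has minimum degree 2, and under E₃ the tree
-- T_{f,D} satisfies (P1), (P2) and (P3).  The particular value of D is not used.
proposition1 : ∀ (m : ℕ) (hE : EdgeSet m) → NoIsolated hE → Regular hE → Strictly2Balanced hE →
    ∃ λ (C : ℕ) → ∀ (n D : ℕ) → IsD n D → ∀ (f : Edge n) (Gr : EdgeSet n) →
      E3 hE D f Gr → E2 hE C D f Gr
proposition1 m hE noiso reg sb = 1 , λ n D _ f Gr e3 →
  let open Tree hE (mindeg2 hE noiso reg sb) D f Gr e3 in P1 , P2 , P3
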